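{- Let $w\in W^0$ and let $\alpha\in\Lambda_+$ be an element of the root lattice. Then ${\bf u}(w){\bf u}(t_\alpha)\emptyset\ne0$, where $\emptyset$ is the empty $(k+1)$-core.
   Context: Fix $k\ge1$; indices mod $k+1$. $W$ is the affine symmetric group with generators $s_0,\dots,s_k$ (relations $s_i^2=1$, $s_is_j=s_js_i$ for $i-j\not\equiv\pm1$, $s_is_{i+1}s_i=s_{i+1}s_is_{i+1}$); $\mathbb{A}$ the affine nilCoxeter algebra with generators $u_0,\dots,u_k$ (relations $u_i^2=0$ and the same commutation and braid relations); ${\bf u}(w)=u_{i_1}\cdots u_{i_m}$ for a reduced word of $w$. Content of the box in row $i$, column $j$: $(j-i)\bmod(k+1)$; $\mathbb{A}$ acts on the free abelian group spanned by $(k+1)$-cores: $u_i\nu$ adds all addable boxes of content $i$ if there is one, else is $0$. $W^0$ = minimal length coset representatives of $W/\langle s_1,\dots,s_k\rangle$. $V=\mathbb{R}^{k+1}/\mathbb{R}(1,\dots,1)$ with action: for $i\ne0$, $s_i\diamond a$ swaps coordinates $i,i+1$; $s_0\diamond(a_1,\dots,a_{k+1})=(a_{k+1}+1,a_2,\dots,a_k,a_1-1)$. $\Lambda_+=\{a:a_1\ge\dots\ge a_{k+1}\}$. The root lattice consists of the elements of $V$ represented by integer vectors with coordinate sum $0$; for such $\alpha$, $t_\alpha\in W$ is the element acting by $t_\alpha\diamond v=v-\alpha$ for all $v\in V$. -}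

module Defs where

open import Data.Nat using (ℕ; zero; suc; _+_; _*_; _≤_; _<ᵇ_; _≡ᵇ_)
open import Data.Nat.DivMod using (_%_)
open import Data.Fin using (Fin; zero; suc; toℕ; inject₁; fromℕ; _≟_)
open import Data.Integer as ℤ using (ℤ)
open import Data.List using (List; []; _∷_; _++_; length)
open import Data.List.Relation.Unary.All using (All)
open import Data.Maybe using (Maybe; just; nothing; _>>=_)
open import Data.Bool using (Bool; true; false; if_then_else_; _∧_; _∨_)
open import Data.Product using (_×_; _,_)
open import Data.Sum using (_⊎_)
open import Data.Empty using (⊥)
open import Relation.Binary.PropositionalEquality using (_≡_; _≢_)
open import Relation.Nullary using (does)

Word : ℕ → Set
Word k = List (Fin (suc k))

-- i and j are adjacent in the cyclic Dynkin diagram: i - j ≡ ±1 mod (k+1)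
Adj : (k : ℕ) → Fin (suc k) → Fin (suc k) → Set
Adj k i j = (toℕ j ≡ suc (toℕ i) % suc k) ⊎ (toℕ i ≡ suc (toℕ j) % suc k)

-- Defining relations of W (equivalently of the nilCoxeter algebra, minus u_i² = 0)
-- The braid relation is imposed only for k ≥ 2 (for k = 1, W is the
-- infinite dihedral group: m(s_0,s_1) = ∞).
data Rel (k : ℕ) : Word k → Word k → Set where
  square  : (i : Fin (suc k)) → Rel k (i ∷ i ∷ []) []
  commute : (i j : Fin (suc k)) → (Adj k i j → ⊥) →
            Rel k (i ∷ j ∷ []) (j ∷ i ∷ [])
  braid   : 2 ≤ k → (i j : Fin (suc k)) → toℕ j ≡ suc (toℕ i) % suc k →
            Rel k (i ∷ j ∷ i ∷ []) (j ∷ i ∷ j ∷ [])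

data _≈W_ {k : ℕ} : Word k → Word k → Set where
  step  : ∀ {a b} → Rel k a b → (l r : Word k) → (l ++ a ++ r) ≈W (l ++ b ++ r)
  refl  : ∀ {a} → a ≈W a
  sym   : ∀ {a b} → a ≈W b → b ≈W a
  trans : ∀ {a b c} → a ≈W b → b ≈W c → a ≈W c

Reduced : (k : ℕ) → Word k → Set
Reduced k x = ∀ (z : Word k) → z ≈W x → length x ≤ length z

-- Letters of the finite parabolic subgroup ⟨s_1,…,s_k⟩
NonZeroLetter : (k : ℕ) → Fin (suc k) → Set
NonZeroLetter k i = i ≡ zero → ⊥

-- y is a word for an element w ∈ W^0 and ℓ(y) = ℓ(w): y has minimal length
-- among all words representing elements of the coset w⟨s_1,…,s_k⟩.
-- (Taking v = [] shows y is reduced.)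
InW0 : (k : ℕ) → Word k → Set
InW0 k y = ∀ (v : Word k) → All (NonZeroLetter k) v →
           ∀ (z : Word k) → z ≈W (y ++ v) → length y ≤ length z

-- The ⋄-action on V, on integer representatives (Fin (suc k) → ℤ);
-- Fin index j ↔ coordinate j+1.

swapIdx : ∀ {n} → Fin n → Fin n → Fin n → Fin n
swapIdx a b j = if does (j ≟ a) then b else (if does (j ≟ b) then a else j)

sAct : (k : ℕ) → Fin (suc k) → (Fin (suc k) → ℤ) → (Fin (suc k) → ℤ)
sAct k zero v j =
  if does (j ≟ zero) then v (fromℕ k) ℤ.+ ℤ.1ℤ
  else (if does (j ≟ fromℕ k) then v zero ℤ.- ℤ.1ℤ else v j)
sAct k (suc i) v j = v (swapIdx (inject₁ i) (suc i) j)

wAct : (k : ℕ) → Word k → (Fin (suc k) → ℤ) → (Fin (suc k) → ℤ)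
wAct k []      v = v
wAct k (i ∷ x) v = sAct k i (wAct k x v)

sumℤ : ∀ {n} → (Fin n → ℤ) → ℤ
sumℤ {zero}  f = ℤ.0ℤ
sumℤ {suc n} f = f zero ℤ.+ sumℤ (λ j → f (suc j))

RootLattice : (k : ℕ) → (Fin (suc k) → ℤ) → Set
RootLattice k α = sumℤ α ≡ ℤ.0ℤ

Dominant : (k : ℕ) → (Fin (suc k) → ℤ) → Set
Dominant k α = ∀ (i j : Fin (suc k)) → toℕ i ≤ toℕ j → α j ℤ.≤ α i

IsTranslation : (k : ℕ) → Word k → (Fin (suc k) → ℤ) → Set
IsTranslation k x α = ∀ (v : Fin (suc k) → ℤ) (j : Fin (suc k)) →
                      wAct k x v j ≡ v j ℤ.- α j

-- Partitions (row lengths λ₁ ≥ λ₂ ≥ ⋯ > 0) and the action of u_i.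
-- Box in row r, column c (1-indexed) has content (c - r) mod (k+1),
-- computed as (c + k·r) mod (k+1).

contentIs : (k : ℕ) → Fin (suc k) → ℕ → ℕ → Bool
contentIs k i r c = ((c + k * r) % suc k) ≡ᵇ toℕ i

-- is the box at the end of a row of length ℓ addable, given the previous
-- row's (old) length (nothing = there is no previous row)
addableAfter : Maybe ℕ → ℕ → Bool
addableAfter nothing  ℓ = true
addableAfter (just m) ℓ = ℓ <ᵇ m

-- add all addable boxes of content i (addability w.r.t. the old shape);
-- returns the new shape and whether some box was added
addAll : (k : ℕ) → Fin (suc k) → ℕ → Maybe ℕ → List ℕ → List ℕ × Bool
addAll k i r p [] =
  if addableAfter p 0 ∧ contentIs k i r 1 then (1 ∷ [] , true) else ([] , false)
addAll k i r p (ℓ ∷ λs) with addAll k i (suc r) (just ℓ) λs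
... | (λs' , b) =
  if addableAfter p ℓ ∧ contentIs k i r (suc ℓ)
  then (suc ℓ ∷ λs' , true) else (ℓ ∷ λs' , b)

-- u_i ν : nothing represents 0
uAct : (k : ℕ) → Fin (suc k) → List ℕ → Maybe (List ℕ)
uAct k i ν with addAll k i 1 nothing ν
... | (ν' , true)  = just ν'
... | (ν' , false) = nothing

uWord : (k : ℕ) → Word k → List ℕ → Maybe (List ℕ)
uWord k []      ν = just ν
uWord k (i ∷ x) ν = uWord k x ν >>= uAct k i

module Submission where

-- The proof works in the abacus (window) model: W acts on ℤ by periodic
-- permutations, s_i exchanging m and m + 1 for m ≡ i - 1 mod (k+1).  A
-- (k+1)-core ν corresponds to the Maya diagram w⁻¹(ℤ_{<0}) of the element
-- w with ν = w·∅, and u_i acts on ν without vanishing precisely when w⁻¹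
-- sends the pair exchanged by s_i upwards across the block boundary (an
-- "up step", module Cores).  So it suffices to check that each letter of
-- y ++ x is applied in an up step (module UpSteps).  This uses the
-- positivity of descents in Coxeter groups (module Positivity, proved via
-- the rank-two analysis of module Dihedral), that y ∈ W^0 is increasing on
-- each window, and that t_α preserves the order inside each window when α
-- is dominant (module DiamondAction computes t_α on positions).

open import Data.Nat using (ℕ; suc)
open import Data.Fin using (Fin)

module Cyclic where
  -- Letters
  -- i, j of the Dynkin diagram are adjacent exactly when j ≡ next i or
  -- i ≡ next j, so these two maps carry all of the diagram combinatorics.

  open import Data.Nat as ℕ using (ℕ; zero; suc)
  import Data.Nat.Properties as ℕP
  open import Data.Nat.DivMod using (_%_; n%n≡0; m<n⇒m%n≡m)
  open import Data.Fin using (Fin; zero; suc; toℕ; inject₁; fromℕ)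
  open import Data.Fin.Properties using (toℕ-inject₁; toℕ-fromℕ; toℕ<n)
  open import Relation.Binary.PropositionalEquality
  open import Data.Empty using (⊥-elim)
  open import Data.Sum using (_⊎_; inj₁; inj₂)
  open import Data.Product using (_,_; ∃)

  prev : ∀ {m} → Fin (suc m) → Fin (suc m)
  prev zero    = fromℕ _
  prev (suc j) = inject₁ j

  liftNext : ∀ {m} → Fin (suc m) → Fin (suc (suc m))
  liftNext zero    = zero
  liftNext (suc j) = suc (suc j)

  next : ∀ {m} → Fin (suc m) → Fin (suc m)
  next {zero}  zero    = zero
  next {suc m} zero    = suc zero
  next {suc m} (suc i) = liftNext (next i)

  next-fromℕ : ∀ m → next (fromℕ m) ≡ zero
  next-fromℕ zero = refl
  next-fromℕ (suc m) rewrite next-fromℕ m = refl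

  next-inject₁ : ∀ {m} (j : Fin m) → next (inject₁ j) ≡ suc j
  next-inject₁ {suc m} zero = refl
  next-inject₁ {suc m} (suc j) rewrite next-inject₁ j = refl

  split : ∀ {m} (i : Fin (suc m)) → (i ≡ fromℕ m) ⊎ ∃ λ j → i ≡ inject₁ j
  split {zero} zero = inj₁ refl
  split {suc m} zero = inj₂ (zero , refl)
  split {suc m} (suc i) with split i
  ... | inj₁ e = inj₁ (cong suc e)
  ... | inj₂ (j , e) = inj₂ (suc j , cong suc e)

  next-prev : ∀ {m} (i : Fin (suc m)) → next (prev i) ≡ i
  next-prev {m} zero = next-fromℕ m
  next-prev (suc j) = next-inject₁ j

  prev-next : ∀ {m} (i : Fin (suc m)) → prev (next i) ≡ i
  prev-next {m} i with split i
  ... | inj₁ refl rewrite next-fromℕ m = refl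
  ... | inj₂ (j , refl) rewrite next-inject₁ j = refl

  prev-injective : ∀ {m} {i j : Fin (suc m)} → prev i ≡ prev j → i ≡ j
  prev-injective {i = i} {j} e = trans (sym (next-prev i)) (trans (cong next e) (next-prev j))

  prev≢ : ∀ {m} (i : Fin (suc (suc m))) → prev i ≢ i
  prev≢ zero ()
  prev≢ (suc j) e = ℕP.1+n≢n (sym (trans (sym (toℕ-inject₁ j)) (cong toℕ e)))

  next≢ : ∀ {m} (i : Fin (suc (suc m))) → next i ≢ i
  next≢ i e = prev≢ i (trans (cong prev (sym e)) (prev-next i))

  toℕ-next : ∀ {m} (i : Fin (suc m)) → toℕ (next i) ≡ suc (toℕ i) % suc m
  toℕ-next {m} i with split i
  ... | inj₁ refl rewrite next-fromℕ m | toℕ-fromℕ m = sym (n%n≡0 (suc m))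
  ... | inj₂ (j , refl) rewrite next-inject₁ j | toℕ-inject₁ j =
    sym (m<n⇒m%n≡m (ℕ.s≤s (toℕ<n j)))

  next²≢ : ∀ {m} → 2 ℕ.≤ m → (i : Fin (suc m)) → next (next i) ≢ i
  next²≢ {suc zero} (ℕ.s≤s ()) i
  next²≢ {suc (suc m)} _ i e with split i
  ... | inj₁ refl rewrite next-fromℕ (suc (suc m)) with e
  ...   | ()
  next²≢ {suc (suc m)} _ i e | inj₂ (j , refl) rewrite next-inject₁ j with split j
  ... | inj₁ refl rewrite next-fromℕ (suc m) with e
  ...   | ()
  next²≢ {suc (suc m)} _ i e | inj₂ (j , refl) | inj₂ (j' , refl) rewrite next-inject₁ (suc j') =
    ℕP.m≢1+n+m (toℕ j') {1} (sym (trans (cong toℕ e) (trans (toℕ-inject₁ (inject₁ j')) (toℕ-inject₁ j'))))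

  one-way-adjacent⇒long : ∀ {m} (s s' : Fin (suc (suc m))) → prev s' ≡ s → prev s ≢ s' → 2 ℕ.≤ suc m
  one-way-adjacent⇒long {zero} zero zero () ne
  one-way-adjacent⇒long {zero} zero (suc zero) e ne = ⊥-elim (ne refl)
  one-way-adjacent⇒long {zero} (suc zero) zero e ne = ⊥-elim (ne refl)
  one-way-adjacent⇒long {zero} (suc zero) (suc zero) () ne
  one-way-adjacent⇒long {suc m} s s' e ne = ℕ.s≤s (ℕ.s≤s ℕ.z≤n)

  increasing : ∀ {m} {A : Set} (_≺_ : A → A → Set) → (∀ {a b c} → a ≺ b → b ≺ c → a ≺ c) →
               (f : Fin (suc m) → A) → (∀ j → f (inject₁ j) ≺ f (suc j)) →
               ∀ r₁ r₂ → toℕ r₁ ℕ.< toℕ r₂ → f r₁ ≺ f r₂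
  increasing {suc m} _≺_ tr f step zero (suc zero) _ = step zero
  increasing {suc m} _≺_ tr f step zero (suc (suc j)) _ =
    tr (step zero) (increasing _≺_ tr (λ r → f (suc r)) (λ r → step (suc r)) zero (suc j) (ℕ.s≤s ℕ.z≤n))
  increasing {suc m} _≺_ tr f step (suc i) (suc j) lt =
    increasing _≺_ tr (λ r → f (suc r)) (λ r → step (suc r)) i j (ℕ.s≤s⁻¹ lt)


module Abacus (k' : ℕ) where
  -- Write n = k + 1 (with k = suc k' ≥ 1).  A
  -- position ⟨ B , r ⟩ stands for the integer B·n + r; its block is B and its
  -- residue r.  The generator s_i acts on ℤ by exchanging m and m + 1
  -- whenever m ≡ i - 1 (mod n); a word acts by composing these exchanges.
  -- This is the window realisation of W as periodic permutations of ℤ.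

  open import Data.Nat using (ℕ; suc)
  open import Data.Fin using (Fin; zero; suc; inject₁; fromℕ)
  open import Data.Fin.Properties using (fromℕ≢inject₁) renaming (_≟_ to _≟F_)
  open import Data.Integer using (ℤ; _+_; _-_; 1ℤ)
  open import Data.Integer.Tactic.RingSolver using (solve-∀)
  open import Relation.Binary.PropositionalEquality
  open import Relation.Nullary using (Dec; yes; no)
  open import Data.Empty using (⊥-elim)
  open import Data.Sum using (inj₁; inj₂)
  open import Data.Product using (_,_)
  open import Data.List using (List; []; _∷_; _++_)
  open Cyclic

  k : ℕ
  k = suc k'

  F : Set
  F = Fin (suc k)

  record Pos : Set where
    constructor ⟨_,_⟩
    field
      blk : ℤ
      res : F
  open Pos public

  sucP : Pos → Pos
  sucP ⟨ B , r ⟩ with r ≟F fromℕ k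
  ... | yes _ = ⟨ B + 1ℤ , zero ⟩
  ... | no _  = ⟨ B , next r ⟩

  sucP-last : ∀ B → sucP ⟨ B , fromℕ k ⟩ ≡ ⟨ B + 1ℤ , zero ⟩
  sucP-last B with fromℕ k ≟F fromℕ k
  ... | yes _ = refl
  ... | no ne = ⊥-elim (ne refl)

  sucP-inject₁ : ∀ B j → sucP ⟨ B , inject₁ j ⟩ ≡ ⟨ B , suc j ⟩
  sucP-inject₁ B j with inject₁ j ≟F fromℕ k
  ... | yes e = ⊥-elim (fromℕ≢inject₁ (sym e))
  ... | no _ = cong ⟨ B ,_⟩ (next-inject₁ j)

  predP : Pos → Pos
  predP ⟨ B , zero ⟩  = ⟨ B - 1ℤ , fromℕ k ⟩
  predP ⟨ B , suc j ⟩ = ⟨ B , inject₁ j ⟩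

  res-sucP : ∀ p → res (sucP p) ≡ next (res p)
  res-sucP ⟨ B , r ⟩ with r ≟F fromℕ k
  ... | yes refl = sym (next-fromℕ k)
  ... | no _ = refl

  res-predP : ∀ p → res (predP p) ≡ prev (res p)
  res-predP ⟨ B , zero ⟩ = refl
  res-predP ⟨ B , suc j ⟩ = refl

  predP-sucP : ∀ p → predP (sucP p) ≡ p
  predP-sucP ⟨ B , r ⟩ with r ≟F fromℕ k
  ... | yes refl = cong ⟨_, fromℕ k ⟩ (+1-1 B)
    where +1-1 : ∀ B → B + 1ℤ - 1ℤ ≡ B
          +1-1 = solve-∀
  ... | no ne with split r
  ...   | inj₁ e = ⊥-elim (ne e)
  ...   | inj₂ (j , refl) rewrite next-inject₁ j = refl

  sucP-predP : ∀ p → sucP (predP p) ≡ p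
  sucP-predP ⟨ B , zero ⟩ with fromℕ k ≟F fromℕ k
  ... | yes _ = cong ⟨_, zero ⟩ (-1+1 B)
    where -1+1 : ∀ B → B - 1ℤ + 1ℤ ≡ B
          -1+1 = solve-∀
  ... | no ne = ⊥-elim (ne refl)
  sucP-predP ⟨ B , suc j ⟩ with inject₁ j ≟F fromℕ k
  ... | yes e = ⊥-elim (fromℕ≢inject₁ (sym e))
  ... | no _ rewrite next-inject₁ j = refl

  act : F → Pos → Pos
  act i p with res p ≟F prev i
  ... | yes _ = sucP p
  ... | no _ with res p ≟F i
  ...   | yes _ = predP p
  ...   | no _ = p

  act-lo : ∀ i p → res p ≡ prev i → act i p ≡ sucP p
  act-lo i p e with res p ≟F prev i
  ... | yes _ = refl
  ... | no ne = ⊥-elim (ne e)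

  act-hi : ∀ i p → res p ≡ i → act i p ≡ predP p
  act-hi i p e with res p ≟F prev i
  ... | yes e' = ⊥-elim (prev≢ i (trans (sym e') e))
  ... | no _ with res p ≟F i
  ...   | yes _ = refl
  ...   | no ne = ⊥-elim (ne e)

  act-oth : ∀ i p → res p ≢ prev i → res p ≢ i → act i p ≡ p
  act-oth i p n1 n2 with res p ≟F prev i
  ... | yes e = ⊥-elim (n1 e)
  ... | no _ with res p ≟F i
  ...   | yes e = ⊥-elim (n2 e)
  ...   | no _ = refl

  act-invol : ∀ i p → act i (act i p) ≡ p
  act-invol i p with res p ≟F prev i
  ... | yes e = trans (act-hi i (sucP p) (trans (res-sucP p) (trans (cong next e) (next-prev i)))) (predP-sucP p)
  ... | no n1 with res p ≟F i
  ...   | yes e = trans (act-lo i (predP p) (trans (res-predP p) (cong prev e))) (sucP-predP p)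
  ...   | no n2 = act-oth i p n1 n2

  Word : Set
  Word = List F

  σ : Word → Pos → Pos
  σ [] p = p
  σ (i ∷ w) p = act i (σ w p)

  σ-++ : ∀ a b p → σ (a ++ b) p ≡ σ a (σ b p)
  σ-++ [] b p = refl
  σ-++ (i ∷ a) b p = cong (act i) (σ-++ a b p)

  shift : ℤ → Pos → Pos
  shift m ⟨ B , r ⟩ = ⟨ B + m , r ⟩

  shift-sucP : ∀ m p → sucP (shift m p) ≡ shift m (sucP p)
  shift-sucP m ⟨ B , r ⟩ with r ≟F fromℕ k
  ... | yes _ = cong ⟨_, zero ⟩ (reorder B m)
    where reorder : ∀ B m → B + m + 1ℤ ≡ B + 1ℤ + m
          reorder = solve-∀
  ... | no _ = refl

  shift-predP : ∀ m p → predP (shift m p) ≡ shift m (predP p)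
  shift-predP m ⟨ B , zero ⟩ = cong ⟨_, fromℕ k ⟩ (reorder B m)
    where reorder : ∀ B m → B + m - 1ℤ ≡ B - 1ℤ + m
          reorder = solve-∀
  shift-predP m ⟨ B , suc j ⟩ = refl

  act-shift : ∀ i m p → act i (shift m p) ≡ shift m (act i p)
  act-shift i m p = by-cases (res p ≟F prev i) (res p ≟F i)
    where
    by-cases : Dec (res p ≡ prev i) → Dec (res p ≡ i) → act i (shift m p) ≡ shift m (act i p)
    by-cases (yes e) _ = trans (act-lo i (shift m p) e) (trans (shift-sucP m p) (cong (shift m) (sym (act-lo i p e))))
    by-cases (no n1) (yes e) = trans (act-hi i (shift m p) e) (trans (shift-predP m p) (cong (shift m) (sym (act-hi i p e))))
    by-cases (no n1) (no n2) = trans (act-oth i (shift m p) n1 n2) (cong (shift m) (sym (act-oth i p n1 n2)))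

  σ-shift : ∀ w m p → σ w (shift m p) ≡ shift m (σ w p)
  σ-shift [] m p = refl
  σ-shift (i ∷ w) m p = trans (cong (act i) (σ-shift w m p)) (act-shift i m (σ w p))


module Relations (k' : ℕ) where

  open import Data.Nat as ℕ using (suc)
  open import Data.Fin using (toℕ)
  open import Data.Fin.Properties using (toℕ-injective) renaming (_≟_ to _≟F_)
  open import Relation.Binary.PropositionalEquality
  open import Relation.Nullary using (¬_; Dec; yes; no)
  open import Relation.Nullary.Decidable using (_⊎-dec_)
  open import Function using (_∘_)
  open import Data.Sum using (_⊎_; inj₁; inj₂)
  open import Data.List using (_++_)
  open import Defs using (Rel; square; commute; braid; _≈W_; step) renaming (refl to wrefl; sym to wsym; trans to wtrans)
  open Cyclic
  open Abacus k'

  adj→ : ∀ {i j : F} → toℕ j ≡ suc (toℕ i) ℕ.% suc k → prev j ≡ i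
  adj→ {i} {j} e = trans (cong prev (toℕ-injective (trans e (sym (toℕ-next i))))) (prev-next i)

  →adj : ∀ {i j : F} → prev j ≡ i → toℕ j ≡ suc (toℕ i) ℕ.% suc k
  →adj {i} {j} e = trans (cong toℕ (trans (sym (next-prev j)) (cong next e))) (toℕ-next i)

  Moved : F → Pos → Set
  Moved i q = res q ≡ prev i ⊎ res q ≡ i

  moved? : ∀ i q → Dec (Moved i q)
  moved? i q = (res q ≟F prev i) ⊎-dec (res q ≟F i)

  act-unmoved : ∀ i q → ¬ Moved i q → act i q ≡ q
  act-unmoved i q nm = act-oth i q (nm ∘ inj₁) (nm ∘ inj₂)

  moved-act : ∀ i q → Moved i q → Moved i (act i q)
  moved-act i q (inj₁ e) = inj₂ (trans (cong res (act-lo i q e)) (trans (res-sucP q) (trans (cong next e) (next-prev i))))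
  moved-act i q (inj₂ e) = inj₁ (trans (cong res (act-hi i q e)) (trans (res-predP q) (cong prev e)))

  moved-disjoint : ∀ {i j} → i ≢ j → prev j ≢ i → prev i ≢ j → ∀ q → Moved i q → ¬ Moved j q
  moved-disjoint i≢j n1 n2 q (inj₁ e) (inj₁ e') = i≢j (prev-injective (trans (sym e) e'))
  moved-disjoint i≢j n1 n2 q (inj₁ e) (inj₂ e') = n2 (trans (sym e) e')
  moved-disjoint i≢j n1 n2 q (inj₂ e) (inj₁ e') = n1 (trans (sym e') e)
  moved-disjoint i≢j n1 n2 q (inj₂ e) (inj₂ e') = i≢j (trans (sym e) e')

  act-comm : ∀ i j → i ≢ j → prev j ≢ i → prev i ≢ j → ∀ p → act i (act j p) ≡ act j (act i p)
  act-comm i j i≢j n1 n2 p with moved? i p | moved? j p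
  ... | yes mi | _ =
    trans (cong (act i) (act-unmoved j p (i-only p mi)))
          (sym (act-unmoved j (act i p) (i-only (act i p) (moved-act i p mi))))
    where i-only : ∀ q → Moved i q → ¬ Moved j q
          i-only = moved-disjoint i≢j n1 n2
  ... | no ni | yes mj =
    trans (act-unmoved i (act j p) (j-only (act j p) (moved-act j p mj)))
          (cong (act j) (sym (act-unmoved i p ni)))
    where j-only : ∀ q → Moved j q → ¬ Moved i q
          j-only = moved-disjoint (≢-sym i≢j) n2 n1
  ... | no ni | no nj =
    trans (cong (act i) (act-unmoved j p nj))
          (trans (act-unmoved i p ni) (sym (trans (cong (act j) (act-unmoved i p ni)) (act-unmoved j p nj))))

  module Braid (k2 : 2 ℕ.≤ k) (i j : F) (pj : prev j ≡ i) where
    a≢i : prev i ≢ i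
    a≢i = prev≢ i
    jn : j ≡ next i
    jn = trans (sym (next-prev j)) (cong next pj)
    i≢j : i ≢ j
    i≢j e = next≢ i (sym (trans e jn))
    a≢j : prev i ≢ j
    a≢j e = next²≢ k2 i (trans (cong next (sym (trans e jn))) (next-prev i))
    j≢i : j ≢ i
    j≢i e = i≢j (sym e)

    -- both sides send a position of residue prev i two steps up, one of
    -- residue j two steps down, and fix all others
    braid-act : ∀ p → act i (act j (act i p)) ≡ act j (act i (act j p))
    braid-act p = by-cases (res p ≟F prev i) (res p ≟F i) (res p ≟F j)
      where
      meet : ∀ {q} → act i (act j (act i p)) ≡ q → act j (act i (act j p)) ≡ q → act i (act j (act i p)) ≡ act j (act i (act j p))
      meet L R = trans L (sym R)
      by-cases : Dec (res p ≡ prev i) → Dec (res p ≡ i) → Dec (res p ≡ j) → act i (act j (act i p)) ≡ act j (act i (act j p))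
      by-cases (yes e) _ _ = meet L R
        where
        r1 : res (sucP p) ≡ prev j
        r1 = trans (res-sucP p) (trans (cong next e) (trans (next-prev i) (sym pj)))
        r2 : res (sucP (sucP p)) ≡ j
        r2 = trans (res-sucP (sucP p)) (trans (cong next r1) (next-prev j))
        L : act i (act j (act i p)) ≡ sucP (sucP p)
        L = trans (cong (λ q → act i (act j q)) (act-lo i p e))
              (trans (cong (act i) (act-lo j (sucP p) r1))
                (act-oth i (sucP (sucP p)) (λ e' → a≢j (trans (sym e') r2)) (λ e' → j≢i (trans (sym r2) e'))))
        R : act j (act i (act j p)) ≡ sucP (sucP p)
        R = trans (cong (λ q → act j (act i q)) (act-oth j p (λ e' → a≢i (trans (sym e) (trans e' pj))) (λ e' → a≢j (trans (sym e) e'))))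
              (trans (cong (act j) (act-lo i p e)) (act-lo j (sucP p) r1))
      by-cases (no _) (yes e) _ = meet L R
        where
        r1 : res (predP p) ≡ prev i
        r1 = trans (res-predP p) (cong prev e)
        e' : res p ≡ prev j
        e' = trans e (sym pj)
        r2 : res (sucP p) ≡ j
        r2 = trans (res-sucP p) (trans (cong next e') (next-prev j))
        L : act i (act j (act i p)) ≡ p
        L = trans (cong (λ q → act i (act j q)) (act-hi i p e))
              (trans (cong (act i) (act-oth j (predP p) (λ x → a≢i (trans (sym r1) (trans x pj))) (λ x → a≢j (trans (sym r1) x))))
                (trans (act-lo i (predP p) r1) (sucP-predP p)))
        R : act j (act i (act j p)) ≡ p
        R = trans (cong (λ q → act j (act i q)) (act-lo j p e'))
              (trans (cong (act j) (act-oth i (sucP p) (λ x → a≢j (sym (trans (sym r2) x))) (λ x → j≢i (trans (sym r2) x))))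
                (trans (act-hi j (sucP p) r2) (predP-sucP p)))
      by-cases (no m1) (no m2) (yes e) = meet L R
        where
        r1 : res (predP p) ≡ i
        r1 = trans (res-predP p) (trans (cong prev e) pj)
        r2 : res (predP (predP p)) ≡ prev i
        r2 = trans (res-predP (predP p)) (cong prev r1)
        L : act i (act j (act i p)) ≡ predP (predP p)
        L = trans (cong (λ q → act i (act j q)) (act-oth i p m1 m2))
              (trans (cong (act i) (act-hi j p e)) (act-hi i (predP p) r1))
        R : act j (act i (act j p)) ≡ predP (predP p)
        R = trans (cong (λ q → act j (act i q)) (act-hi j p e))
              (trans (cong (act j) (act-hi i (predP p) r1))
                (act-oth j (predP (predP p)) (λ x → a≢i (trans (sym r2) (trans x pj))) (λ x → a≢j (trans (sym r2) x))))
      by-cases (no m1) (no m2) (no m3) = meet L R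
        where
        m4 : res p ≢ prev j
        m4 x = m2 (trans x pj)
        L : act i (act j (act i p)) ≡ p
        L = trans (cong (λ q → act i (act j q)) (act-oth i p m1 m2))
              (trans (cong (act i) (act-oth j p m4 m3)) (act-oth i p m1 m2))
        R : act j (act i (act j p)) ≡ p
        R = trans (cong (λ q → act j (act i q)) (act-oth j p m4 m3))
              (trans (cong (act j) (act-oth i p m1 m2)) (act-oth j p m4 m3))

  σ-Rel : ∀ {a b} → Rel k a b → ∀ p → σ a p ≡ σ b p
  σ-Rel (square i) p = act-invol i p
  σ-Rel (commute i j nadj) p with i ≟F j
  ... | yes refl = refl
  ... | no i≢j = act-comm i j i≢j (λ e → nadj (inj₁ (→adj e))) (λ e → nadj (inj₂ (→adj e))) p
  σ-Rel (braid k2 i j e) p = Braid.braid-act k2 i j (adj→ e) p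

  σ-resp : ∀ {a b : Word} → a ≈W b → ∀ p → σ a p ≡ σ b p
  σ-resp (step {a} {b} rl l r) p = begin
    σ (l ++ a ++ r) p   ≡⟨ σ-++ l (a ++ r) p ⟩
    σ l (σ (a ++ r) p)  ≡⟨ cong (σ l) (σ-++ a r p) ⟩
    σ l (σ a (σ r p))   ≡⟨ cong (σ l) (σ-Rel rl (σ r p)) ⟩
    σ l (σ b (σ r p))   ≡⟨ cong (σ l) (sym (σ-++ b r p)) ⟩
    σ l (σ (b ++ r) p)  ≡⟨ sym (σ-++ l (b ++ r) p) ⟩
    σ (l ++ b ++ r) p   ∎
    where open ≡-Reasoning
  σ-resp wrefl p = refl
  σ-resp (wsym e) p = sym (σ-resp e p)
  σ-resp (wtrans e f) p = trans (σ-resp e p) (σ-resp f p)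


module Words (k' : ℕ) where

  open import Data.Nat as ℕ using (ℕ; zero; suc; _≤_; _<_; _+_)
  import Data.Nat.Properties as ℕP
  open import Relation.Binary.PropositionalEquality hiding ([_])
  open import Data.Empty using (⊥; ⊥-elim)
  open import Data.Sum using (_⊎_; inj₁; inj₂)
  open import Data.Product using (_,_; ∃₂)
  open import Data.List using ([]; _∷_; _++_; length; reverse; [_])
  open import Data.List.Properties using (++-assoc; reverse-++; length-++; ++-identityʳ; length-reverse; reverse-involutive; unfold-reverse)
  open import Data.Bool using (Bool; true; false; not; _xor_)
  open import Data.Bool.Properties using (not-distribˡ-xor)
  open import Relation.Nullary using (yes; no; contradiction)
  open import Defs using (Rel; square; commute; braid; _≈W_; step; Adj; Reduced) renaming (refl to wrefl; sym to wsym; trans to wtrans)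
  open Abacus k'

  ≈subst : ∀ {a b c d : Word} → a ≡ c → b ≡ d → a ≈W b → c ≈W d
  ≈subst refl refl e = e

  cong≈ : ∀ {a b : Word} (l r : Word) → a ≈W b → (l ++ a ++ r) ≈W (l ++ b ++ r)
  cong≈ l r (step {a} {b} rl l' r') =
    ≈subst (sym (reassoc a)) (sym (reassoc b)) (step rl (l ++ l') (r' ++ r))
    where
    reassoc : ∀ a → l ++ (l' ++ a ++ r') ++ r ≡ (l ++ l') ++ a ++ (r' ++ r)
    reassoc a = trans (cong (l ++_) (trans (++-assoc l' (a ++ r') r) (cong (l' ++_) (++-assoc a r' r))))
                      (sym (++-assoc l l' (a ++ (r' ++ r))))
  cong≈ l r wrefl = wrefl
  cong≈ l r (wsym e) = wsym (cong≈ l r e)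
  cong≈ l r (wtrans e f) = wtrans (cong≈ l r e) (cong≈ l r f)

  ≈++ʳ : ∀ {a b : Word} (r : Word) → a ≈W b → (a ++ r) ≈W (b ++ r)
  ≈++ʳ r e = cong≈ [] r e

  ≈++ˡ : ∀ {a b : Word} (l : Word) → a ≈W b → (l ++ a) ≈W (l ++ b)
  ≈++ˡ {a} {b} l e = ≈subst (cong (l ++_) (++-identityʳ a)) (cong (l ++_) (++-identityʳ b)) (cong≈ l [] e)

  -- reversal (the inverse in W) respects ≈W, since the relations are
  -- palindromic up to symmetry of adjacency
  rev≈ : ∀ {a b : Word} → a ≈W b → reverse a ≈W reverse b
  rev≈ (step {a} {b} rl l r) = ≈subst (sym (rev3 a)) (sym (rev3 b)) (cong≈ (reverse r) (reverse l) (rel-rev rl))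
    where
    rev3 : ∀ a → reverse (l ++ a ++ r) ≡ reverse r ++ reverse a ++ reverse l
    rev3 a = trans (reverse-++ l (a ++ r)) (trans (cong (_++ reverse l) (reverse-++ a r)) (++-assoc (reverse r) (reverse a) (reverse l)))
    adj-sym : ∀ {i j} → Adj k i j → Adj k j i
    adj-sym (inj₁ x) = inj₂ x
    adj-sym (inj₂ y) = inj₁ y
    rel-rev : ∀ {a b : Word} → Rel k a b → reverse a ≈W reverse b
    rel-rev (square i) = step (square i) [] []
    rel-rev (commute i j na) = step (commute j i (λ x → na (adj-sym x))) [] []
    rel-rev (braid k2 i j e) = step (braid k2 i j e) [] []
  rev≈ wrefl = wrefl
  rev≈ (wsym e) = wsym (rev≈ e)
  rev≈ (wtrans e f) = wtrans (rev≈ e) (rev≈ f)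

  -- parity of a natural number (true = odd)
  par : ℕ → Bool
  par zero = false
  par (suc n) = not (par n)

  par-+ : ∀ m n → par (m + n) ≡ par m xor par n
  par-+ zero n = refl
  par-+ (suc m) n = trans (cong not (par-+ m n)) (not-distribˡ-xor (par m) (par n))

  par-++ : ∀ (l a r : Word) → par (length (l ++ a ++ r)) ≡ par (length l) xor (par (length a) xor par (length r))
  par-++ l a r rewrite length-++ l {a ++ r} | length-++ a {r} | par-+ (length l) (length a + length r) | par-+ (length a) (length r) = refl

  -- every defining relation has sides of equal length parity, hence so do
  -- equivalent words
  rel-par : ∀ {a b : Word} → Rel k a b → par (length a) ≡ par (length b)
  rel-par (square i) = refl
  rel-par (commute i j x) = refl
  rel-par (braid x i j x₁) = refl

  par-resp : ∀ {a b : Word} → a ≈W b → par (length a) ≡ par (length b)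
  par-resp (step {a} {b} rl l r) rewrite par-++ l a r | par-++ l b r | rel-par rl = refl
  par-resp wrefl = refl
  par-resp (wsym e) = sym (par-resp e)
  par-resp (wtrans e f) = trans (par-resp e) (par-resp f)

  σ-rev-l : ∀ w p → σ (reverse w) (σ w p) ≡ p
  σ-rev-l [] p = refl
  σ-rev-l (i ∷ w) p = trans (cong (λ u → σ u (act i (σ w p))) (unfold-reverse i w))
    (trans (σ-++ (reverse w) [ i ] (act i (σ w p))) (trans (cong (σ (reverse w)) (act-invol i (σ w p))) (σ-rev-l w p)))

  σ-rev-r : ∀ w p → σ w (σ (reverse w) p) ≡ p
  σ-rev-r w p = trans (cong (λ u → σ u (σ (reverse w) p)) (sym (reverse-involutive w))) (σ-rev-l (reverse w) p)

  snoc-view : (u : Word) → u ≡ [] ⊎ ∃₂ λ u' t → u ≡ u' ++ [ t ]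
  snoc-view [] = inj₁ refl
  snoc-view (x ∷ u) with snoc-view u
  ... | inj₁ refl = inj₂ ([] , x , refl)
  ... | inj₂ (u' , t , refl) = inj₂ (x ∷ u' , t , refl)

  length-snoc : ∀ (u : Word) x → length (u ++ [ x ]) ≡ suc (length u)
  length-snoc u x = trans (length-++ u) (ℕP.+-comm (length u) 1)

  snoc² : ∀ (u : Word) a b → (u ++ [ a ]) ++ [ b ] ≡ u ++ a ∷ b ∷ []
  snoc² [] a b = refl
  snoc² (x ∷ u) a b = cong (x ∷_) (snoc² u a b)

  snoc³ : ∀ (u : Word) a b c → ((u ++ [ a ]) ++ [ b ]) ++ [ c ] ≡ u ++ a ∷ b ∷ c ∷ []
  snoc³ [] a b c = refl
  snoc³ (x ∷ u) a b c = cong (x ∷_) (snoc³ u a b c)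

  snoc⁴ : ∀ (u : Word) a b c d → (((u ++ [ a ]) ++ [ b ]) ++ [ c ]) ++ [ d ] ≡ u ++ a ∷ b ∷ c ∷ d ∷ []
  snoc⁴ [] a b c d = refl
  snoc⁴ (x ∷ u) a b c d = cong (x ∷_) (snoc⁴ u a b c d)

  Red : Word → Set
  Red = Reduced k

  red-prefix : ∀ (a b : Word) → Red (a ++ b) → Red a
  red-prefix a b r z z≈a = ℕP.+-cancelʳ-≤ (length b) (length a) (length z)
    (subst₂ _≤_ (length-++ a) (length-++ z) (r (z ++ b) (≈++ʳ b z≈a)))

  red-suffix : ∀ (a b : Word) → Red (a ++ b) → Red b
  red-suffix a b r z z≈b = ℕP.+-cancelˡ-≤ (length a) (length b) (length z)
    (subst₂ _≤_ (length-++ a) (length-++ a) (r (a ++ z) (≈++ˡ a z≈b)))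

  red-rev : ∀ (w : Word) → Red w → Red (reverse w)
  red-rev w r z z≈ = subst₂ _≤_ (sym (length-reverse w)) (length-reverse z)
    (r (reverse z) (≈subst refl (reverse-involutive w) (rev≈ z≈)))

  red-sq : ∀ (l r : Word) (i : F) → Red (l ++ i ∷ i ∷ r) → ⊥
  red-sq l r i red = ℕP.<-irrefl refl (ℕP.≤-trans (ℕP.n≤1+n _) (subst (_≤ length (l ++ r)) eq (red (l ++ r) (wsym (step (square i) l r)))))
    where
    eq : length (l ++ i ∷ i ∷ r) ≡ suc (suc (length (l ++ r)))
    eq rewrite length-++ l {i ∷ i ∷ r} | length-++ l {r} = trans (ℕP.+-suc (length l) (suc (length r))) (cong suc (ℕP.+-suc (length l) (length r)))

  red-end-short : ∀ (l a b : Word) → Red (l ++ a) → a ≈W b → length b < length a → ⊥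
  red-end-short l a b red e lt = ℕP.<-irrefl refl (ℕP.<-≤-trans shorter (red (l ++ b) (wsym (≈++ˡ l e))))
    where
    shorter : length (l ++ b) < length (l ++ a)
    shorter rewrite length-++ l {b} | length-++ l {a} = ℕP.+-monoʳ-< (length l) lt

  -- To see that v ++ [ x ] is reduced it suffices to compare with v: an
  -- equivalent word shorter than v ++ [ x ] has the other length parity,
  -- hence is even shorter than v.
  red-snoc : ∀ (v : Word) x → (∀ z → z ≈W (v ++ [ x ]) → length v ≤ length z) → Red (v ++ [ x ])
  red-snoc v x long z z≈ with length (v ++ [ x ]) ℕP.≤? length z
  ... | yes p = p
  ... | no np with ℕP.m≤n⇒m<n∨m≡n (ℕ.s≤s⁻¹ (subst (length z <_) (length-snoc v x) (ℕP.≰⇒> np)))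
  ...   | inj₁ lt = contradiction (long z z≈) (ℕP.<⇒≱ lt)
  ...   | inj₂ e = ⊥-elim (par-differs (subst (λ m → par m ≡ not (par (length v))) e (trans (par-resp z≈) (cong par (length-snoc v x)))))
    where
    par-differs : ∀ {b} → b ≡ not b → ⊥
    par-differs {true} ()
    par-differs {false} ()


module Order (k' : ℕ) where
  -- A letter s is positive for a
  -- word w when w keeps the pair of positions exchanged by s in block 0 in
  -- order; this is the abacus form of "w(α_s) is a positive root".

  open import Data.Nat as ℕ using (ℕ; zero; suc)
  import Data.Nat.Properties as ℕP
  open import Data.Fin using (zero; suc; toℕ; inject₁; fromℕ)
  open import Relation.Binary using (tri<; tri≈; tri>)
  open import Data.Fin.Properties using (toℕ-injective; toℕ-inject₁; toℕ-fromℕ; toℕ<n)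
  open import Data.Integer as ℤ using (_+_; _<_; 0ℤ; 1ℤ)
  import Data.Integer.Properties as ℤP
  open import Relation.Binary.PropositionalEquality
  open import Relation.Nullary using (Dec; yes; no)
  open import Data.Empty using (⊥; ⊥-elim)
  open import Data.Sum using (_⊎_; inj₁; inj₂)
  open import Data.Product using (_,_; _×_)
  open Cyclic
  open Abacus k'

  infix 4 _<P_ _≤P_
  _<P_ : Pos → Pos → Set
  p <P q = blk p < blk q ⊎ (blk p ≡ blk q × toℕ (res p) ℕ.< toℕ (res q))

  _≤P_ : Pos → Pos → Set
  p ≤P q = p ≡ q ⊎ p <P q

  <P-trans : ∀ {p q r} → p <P q → q <P r → p <P r
  <P-trans (inj₁ a) (inj₁ b) = inj₁ (ℤP.<-trans a b)
  <P-trans (inj₁ a) (inj₂ (e , _)) = inj₁ (subst (_ <_) e a)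
  <P-trans (inj₂ (e , _)) (inj₁ b) = inj₁ (subst (_< _) (sym e) b)
  <P-trans (inj₂ (e , a)) (inj₂ (e' , b)) = inj₂ (trans e e' , ℕP.<-trans a b)

  <P-irrefl : ∀ {p} → p <P p → ⊥
  <P-irrefl (inj₁ a) = ℤP.<-irrefl refl a
  <P-irrefl (inj₂ (_ , a)) = ℕP.<-irrefl refl a

  <P-asym : ∀ {p q} → p <P q → q <P p → ⊥
  <P-asym a b = <P-irrefl (<P-trans a b)

  <P-dec : ∀ p q → Dec (p <P q)
  <P-dec p q with blk p ℤP.<? blk q
  ... | yes a = yes (inj₁ a)
  ... | no na with blk p ℤ.≟ blk q
  ...   | no ne = no λ { (inj₁ a) → na a ; (inj₂ (e , _)) → ne e }
  ...   | yes e with toℕ (res p) ℕP.<? toℕ (res q)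
  ...     | yes b = yes (inj₂ (e , b))
  ...     | no nb = no λ { (inj₁ a) → na a ; (inj₂ (_ , b)) → nb b }

  ≤<-trans : ∀ {p q r} → p ≤P q → q <P r → p <P r
  ≤<-trans (inj₁ refl) b = b
  ≤<-trans (inj₂ a) b = <P-trans a b

  <≤-trans : ∀ {p q r} → p <P q → q ≤P r → p <P r
  <≤-trans a (inj₁ refl) = a
  <≤-trans a (inj₂ b) = <P-trans a b

  ≤<-irr : ∀ {p q} → p ≤P q → q <P p → ⊥
  ≤<-irr (inj₁ refl) b = <P-irrefl b
  ≤<-irr (inj₂ a) b = <P-asym a b

  shift-mono : ∀ m {p q} → p <P q → shift m p <P shift m q
  shift-mono m (inj₁ a) = inj₁ (ℤP.+-monoˡ-< m a)
  shift-mono m (inj₂ (e , b)) = inj₂ (cong (_+ m) e , b)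

  sucP-inc : ∀ p → p <P sucP p
  sucP-inc ⟨ B , r ⟩ with split r
  ... | inj₁ refl rewrite sucP-last B = inj₁ (ℤP.suc[i]≤j⇒i<j (ℤP.≤-reflexive (ℤP.+-comm 1ℤ B)))
  ... | inj₂ (j , refl) rewrite sucP-inject₁ B j = inj₂ (refl , ℕP.≤-reflexive (cong suc (toℕ-inject₁ j)))

  predP-dec : ∀ p → predP p <P p
  predP-dec p = subst (predP p <P_) (sucP-predP p) (sucP-inc (predP p))

  discrete : ∀ {p q} → p <P q → sucP p ≤P q
  discrete {⟨ B , r ⟩} {⟨ B' , r' ⟩} lt with split r
  ... | inj₁ refl rewrite sucP-last B = from-last lt
    where
    from-last : ⟨ B , fromℕ k ⟩ <P ⟨ B' , r' ⟩ → ⟨ B + 1ℤ , zero ⟩ ≤P ⟨ B' , r' ⟩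
    from-last (inj₂ (_ , l)) = ⊥-elim (ℕP.<-irrefl refl (ℕP.<-≤-trans (subst (ℕ._< toℕ r') (toℕ-fromℕ k) l) (ℕ.s≤s⁻¹ (toℕ<n r'))))
    from-last (inj₁ l) with B + 1ℤ ℤ.≟ B'
    ... | no ne = inj₂ (inj₁ (ℤP.≤∧≢⇒< (subst (ℤ._≤ B') (ℤP.+-comm 1ℤ B) (ℤP.i<j⇒suc[i]≤j l)) ne))
    ... | yes refl = zero-first r'
      where
      zero-first : ∀ r → ⟨ B' , zero ⟩ ≤P ⟨ B' , r ⟩
      zero-first zero = inj₁ refl
      zero-first (suc r) = inj₂ (inj₂ (refl , ℕ.s≤s ℕ.z≤n))
  ... | inj₂ (j , refl) rewrite sucP-inject₁ B j = from-inner lt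
    where
    from-inner : ⟨ B , inject₁ j ⟩ <P ⟨ B' , r' ⟩ → ⟨ B , suc j ⟩ ≤P ⟨ B' , r' ⟩
    from-inner (inj₁ l) = inj₂ (inj₁ l)
    from-inner (inj₂ (e , l)) with ℕP.m≤n⇒m<n∨m≡n (subst (λ x → suc x ℕ.≤ toℕ r') (toℕ-inject₁ j) l)
    ... | inj₁ l' = inj₂ (inj₂ (e , l'))
    ... | inj₂ e' = inj₁ (cong₂ ⟨_,_⟩ e (toℕ-injective e'))

  sucP-mono : ∀ {p q} → p <P q → sucP p <P sucP q
  sucP-mono {p} {q} lt = ≤<-trans (discrete lt) (sucP-inc q)

  sucN : ℕ → Pos → Pos
  sucN zero p = p
  sucN (suc d) p = sucP (sucN d p)

  predN : ℕ → Pos → Pos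
  predN zero p = p
  predN (suc d) p = predP (predN d p)

  sucN-sucP : ∀ d p → sucN (suc d) p ≡ sucN d (sucP p)
  sucN-sucP zero p = refl
  sucN-sucP (suc d) p = cong sucP (sucN-sucP d p)

  sucN-predP : ∀ d p → sucN d (predP p) ≡ predP (sucN d p)
  sucN-predP zero p = refl
  sucN-predP (suc d) p = trans (cong sucP (sucN-predP d p)) (trans (sucP-predP (sucN d p)) (sym (predP-sucP (sucN d p))))

  predN-predP : ∀ d p → predN d (predP p) ≡ predP (predN d p)
  predN-predP zero p = refl
  predN-predP (suc d) p = cong predP (predN-predP d p)

  predN-sucN : ∀ d p → predN d (sucN d p) ≡ p
  predN-sucN zero p = refl
  predN-sucN (suc d) p = trans (sym (predN-predP d (sucP (sucN d p)))) (trans (cong (predN d) (predP-sucP (sucN d p))) (predN-sucN d p))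

  predN-+ : ∀ a b x → predN (a ℕ.+ b) x ≡ predN a (predN b x)
  predN-+ zero b x = refl
  predN-+ (suc a) b x = cong predP (predN-+ a b x)

  sucN-inc : ∀ d p → p <P sucN (suc d) p
  sucN-inc zero p = sucP-inc p
  sucN-inc (suc d) p = <P-trans (sucN-inc d p) (sucP-inc _)

  sucN-lt : ∀ {a b} → a ℕ.< b → ∀ p → sucN a p <P sucN b p
  sucN-lt {zero} {suc b} _ p = sucN-inc b p
  sucN-lt {suc a} {suc b} l p = sucP-mono (sucN-lt (ℕ.s≤s⁻¹ l) p)

  sucN-le : ∀ {a b} → a ℕ.≤ b → ∀ p → sucN a p ≤P sucN b p
  sucN-le {a} {b} le p with ℕP.m≤n⇒m<n∨m≡n le
  ... | inj₂ refl = inj₁ refl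
  ... | inj₁ lt = inj₂ (sucN-lt lt p)

  sucN-injective : ∀ {a b} p → sucN a p ≡ sucN b p → a ≡ b
  sucN-injective {a} {b} p e with ℕP.<-cmp a b
  ... | tri< l _ _ = ⊥-elim (<P-irrefl (subst (_<P _) e (sucN-lt l p)))
  ... | tri≈ _ x _ = x
  ... | tri> _ _ l = ⊥-elim (<P-irrefl (subst (_ <P_) e (sucN-lt l p)))

  predN-le : ∀ d p → predN d p ≤P p
  predN-le zero p = inj₁ refl
  predN-le (suc d) p = inj₂ (<≤-trans (predP-dec _) (predN-le d p))

  lo : F → Pos
  lo s = ⟨ 0ℤ , prev s ⟩

  hi : F → Pos
  hi s = sucP (lo s)

  res-hi : ∀ s → res (hi s) ≡ s
  res-hi s = trans (res-sucP (lo s)) (next-prev s)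

  act-lo-s : ∀ s → act s (lo s) ≡ hi s
  act-lo-s s = act-lo s (lo s) refl

  act-hi-s : ∀ s → act s (hi s) ≡ lo s
  act-hi-s s = trans (act-hi s (hi s) (res-hi s)) (predP-sucP (lo s))

  Positive : Word → F → Set
  Positive w s = σ w (lo s) <P σ w (hi s)

  lo-shift : ∀ t p → res p ≡ prev t → p ≡ shift (blk p) (lo t)
  lo-shift t ⟨ B , r ⟩ refl = cong ⟨_, r ⟩ (sym (ℤP.+-identityˡ B))

  -- by periodicity, positivity of t means that w keeps every pair exchanged
  -- by t in order
  pos-at : ∀ w t p → Positive w t → res p ≡ prev t → σ w p <P σ w (sucP p)
  pos-at w t p pw e = subst₂ _<P_ (sym lower) (sym upper) (shift-mono (blk p) pw)
    where
    p-shift : p ≡ shift (blk p) (lo t)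
    p-shift = lo-shift t p e
    lower : σ w p ≡ shift (blk p) (σ w (lo t))
    lower = trans (cong (σ w) p-shift) (σ-shift w (blk p) (lo t))
    upper : σ w (sucP p) ≡ shift (blk p) (σ w (hi t))
    upper = trans (cong (λ x → σ w (sucP x)) p-shift) (trans (cong (σ w) (shift-sucP (blk p) (lo t))) (σ-shift w (blk p) (hi t)))


module Dihedral (k' : ℕ) where
  -- The rank-two step of the exchange argument (Humphreys, Reflection
  -- Groups and Coxeter Groups, 5.4).  Let v keep in order both the pair of
  -- s and the pair of s'.  Then v also keeps in order the pair
  -- σ u (lo s) < σ u (hi s) for every word u in s, s' with u ++ [ s ]
  -- reduced: in root language, u(α_s) is a non-negative combination of α_s
  -- and α_s'.  The proof distinguishes the three types of the parabolic
  -- subgroup ⟨s, s'⟩: commuting, braid (order 6) and infinite dihedral (k = 1).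

  open import Data.Nat as ℕ using (ℕ; zero; suc)
  open import Data.Fin.Properties using () renaming (_≟_ to _≟F_)
  open import Relation.Binary.PropositionalEquality hiding ([_])
  open import Relation.Nullary using (yes; no)
  open import Data.Empty using (⊥; ⊥-elim)
  open import Data.Sum using (_⊎_; inj₁; inj₂)
  open import Data.Product using (_,_; _×_)
  open import Data.List using ([]; _∷_; _++_; [_])
  open import Data.List.Relation.Unary.All using (All; []; _∷_)
  open import Defs using (Adj; square; commute; braid; _≈W_; step) renaming (sym to wsym; trans to wtrans)
  open Cyclic
  open Abacus k'
  open Relations k'
  open Words k'
  open Order k'

  IWord : F → F → Word → Set
  IWord s s' = All (λ t → t ≡ s ⊎ t ≡ s')

  iw-last : ∀ {s s'} u t → IWord s s' (u ++ [ t ]) → IWord s s' u × (t ≡ s ⊎ t ≡ s')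
  iw-last [] t (p ∷ []) = [] , p
  iw-last (x ∷ u) t (p ∷ ps) with iw-last u t ps
  ... | a , b = (p ∷ a) , b

  module Dih (s s' : F) (s≢s' : s ≢ s') (v : Word) (pv : Positive v s) (pv' : Positive v s') where

    Goal : Word → Set
    Goal u = σ v (σ u (lo s)) <P σ v (σ u (hi s))

    -- A word u in s, s' with u ++ [ s ] reduced alternates and ends in s';
    -- so either it has length ≤ 2, or s' s s' s is reduced.
    alternating-end : ∀ u → IWord s s' u → Red (u ++ [ s ]) →
                      u ≡ [] ⊎ u ≡ [ s' ] ⊎ u ≡ s ∷ s' ∷ [] ⊎ Red (s' ∷ s ∷ s' ∷ s ∷ [])
    alternating-end u iw red with snoc-view u
    ... | inj₁ refl = inj₁ refl
    ... | inj₂ (u₁ , t₁ , refl) with iw-last u₁ t₁ iw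
    ...   | _ , inj₁ refl = ⊥-elim (red-sq u₁ [] s (subst Red (snoc² u₁ s s) red))
    ...   | iw₁ , inj₂ refl with snoc-view u₁
    ...     | inj₁ refl = inj₂ (inj₁ refl)
    ...     | inj₂ (u₂ , t₂ , refl) with iw-last u₂ t₂ iw₁
    ...       | _ , inj₂ refl = ⊥-elim (red-sq u₂ [ s ] s' (subst Red (snoc³ u₂ s' s' s) red))
    ...       | iw₂ , inj₁ refl with snoc-view u₂
    ...         | inj₁ refl = inj₂ (inj₂ (inj₁ refl))
    ...         | inj₂ (u₃ , t₃ , refl) with iw-last u₃ t₃ iw₂
    ...           | _ , inj₁ refl = ⊥-elim (red-sq u₃ (s' ∷ [ s ]) s (subst Red (snoc⁴ u₃ s s s' s) red))
    ...           | _ , inj₂ refl = inj₂ (inj₂ (inj₂ (red-suffix u₃ _ (subst Red (snoc⁴ u₃ s' s s' s) red))))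

    goal-from : ∀ u {a b} → σ u (lo s) ≡ a → σ u (hi s) ≡ b → σ v a <P σ v b → Goal u
    goal-from u ea eb = subst₂ (λ a b → σ v a <P σ v b) (sym ea) (sym eb)

    -- s and s' commute: s s' s ≈ s' is not reduced, and s' fixes the pair of s
    module Commuting (n1 : prev s ≢ s') (n2 : prev s' ≢ s) where
      not-adjacent : Adj k s s' → ⊥
      not-adjacent (inj₁ x) = n2 (adj→ x)
      not-adjacent (inj₂ x) = n1 (adj→ x)

      sss-not-reduced : Red (s ∷ s' ∷ s ∷ []) → ⊥
      sss-not-reduced r = red-end-short [] (s ∷ s' ∷ s ∷ []) [ s' ] r sss≈s' (ℕ.s≤s (ℕ.s≤s ℕ.z≤n))
        where
        sss≈s' : (s ∷ s' ∷ s ∷ []) ≈W [ s' ]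
        sss≈s' = wtrans (step (commute s s' not-adjacent) [] [ s ]) (step (square s) [ s' ] [])

      lo-fix : act s' (lo s) ≡ lo s
      lo-fix = act-oth s' (lo s) (λ e → s≢s' (prev-injective e)) n1

      hi-fix : act s' (hi s) ≡ hi s
      hi-fix = act-oth s' (hi s) (λ e → n2 (sym (trans (sym (res-hi s)) e))) (λ e → s≢s' (trans (sym (res-hi s)) e))

      dih : ∀ u → IWord s s' u → Red (u ++ [ s ]) → Goal u
      dih u iw red with alternating-end u iw red
      ... | inj₁ refl = pv
      ... | inj₂ (inj₁ refl) = goal-from [ s' ] lo-fix hi-fix pv
      ... | inj₂ (inj₂ (inj₁ refl)) = ⊥-elim (sss-not-reduced red)
      ... | inj₂ (inj₂ (inj₂ r)) = ⊥-elim (sss-not-reduced (red-suffix [ s' ] _ r))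

    braid-not-reduced : (s' ∷ s ∷ s' ∷ s ∷ []) ≈W (s ∷ s' ∷ []) → Red (s' ∷ s ∷ s' ∷ s ∷ []) → ⊥
    braid-not-reduced e r = red-end-short [] _ _ r e (ℕ.s≤s (ℕ.s≤s (ℕ.s≤s ℕ.z≤n)))

    -- s' = next s: s' fixes lo s and moves hi s one step up
    module BraidUp (e : prev s' ≡ s) (ne : prev s ≢ s') where
      k2 : 2 ℕ.≤ k
      k2 = one-way-adjacent⇒long s s' e ne

      res-hi-s : res (hi s) ≡ prev s'
      res-hi-s = trans (res-hi s) (sym e)

      res-above : res (sucP (hi s)) ≡ s'
      res-above = trans (res-sucP (hi s)) (trans (cong next res-hi-s) (next-prev s'))

      lo-fix : act s' (lo s) ≡ lo s
      lo-fix = act-oth s' (lo s) (λ x → s≢s' (prev-injective x)) ne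

      hi-up : act s' (hi s) ≡ sucP (hi s)
      hi-up = act-lo s' (hi s) res-hi-s

      above-fix : act s (sucP (hi s)) ≡ sucP (hi s)
      above-fix = act-oth s (sucP (hi s)) (λ x → ne (sym (trans (sym res-above) x))) (λ x → s≢s' (sym (trans (sym res-above) x)))

      pair-s' : σ v (hi s) <P σ v (sucP (hi s))
      pair-s' = pos-at v s' (hi s) pv' res-hi-s

      dih : ∀ u → IWord s s' u → Red (u ++ [ s ]) → Goal u
      dih u iw red with alternating-end u iw red
      ... | inj₁ refl = pv
      ... | inj₂ (inj₁ refl) = goal-from [ s' ] lo-fix hi-up (<P-trans pv pair-s')
      ... | inj₂ (inj₂ (inj₁ refl)) =
        goal-from (s ∷ s' ∷ []) (trans (cong (act s) lo-fix) (act-lo-s s)) (trans (cong (act s) hi-up) above-fix) pair-s'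
      ... | inj₂ (inj₂ (inj₂ r)) = ⊥-elim (braid-not-reduced sss≈ss r)
        where
        sss≈ss : (s' ∷ s ∷ s' ∷ s ∷ []) ≈W (s ∷ s' ∷ [])
        sss≈ss = wtrans (wsym (step (braid k2 s s' (→adj e)) [] [ s ])) (step (square s) (s ∷ s' ∷ []) [])

    -- s = next s': s' moves lo s one step down and fixes hi s
    module BraidDown (e : prev s ≡ s') (ne : prev s' ≢ s) where
      k2 : 2 ℕ.≤ k
      k2 = one-way-adjacent⇒long s' s e ne

      res-below : res (predP (lo s)) ≡ prev s'
      res-below = trans (res-predP (lo s)) (cong prev e)

      lo-down : act s' (lo s) ≡ predP (lo s)
      lo-down = act-hi s' (lo s) e

      hi-fix : act s' (hi s) ≡ hi s
      hi-fix = act-oth s' (hi s) (λ x → ne (sym (trans (sym (res-hi s)) x))) (λ x → s≢s' (trans (sym (res-hi s)) x))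

      below-fix : act s (predP (lo s)) ≡ predP (lo s)
      below-fix = act-oth s (predP (lo s)) (λ x → s≢s' (sym (prev-injective (trans (sym res-below) x)))) (λ x → ne (trans (sym res-below) x))

      pair-s' : σ v (predP (lo s)) <P σ v (lo s)
      pair-s' = subst (λ x → σ v (predP (lo s)) <P σ v x) (sucP-predP (lo s)) (pos-at v s' (predP (lo s)) pv' res-below)

      dih : ∀ u → IWord s s' u → Red (u ++ [ s ]) → Goal u
      dih u iw red with alternating-end u iw red
      ... | inj₁ refl = pv
      ... | inj₂ (inj₁ refl) = goal-from [ s' ] lo-down hi-fix (<P-trans pair-s' pv)
      ... | inj₂ (inj₂ (inj₁ refl)) =
        goal-from (s ∷ s' ∷ []) (trans (cong (act s) lo-down) below-fix) (trans (cong (act s) hi-fix) (act-hi-s s)) pair-s'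
      ... | inj₂ (inj₂ (inj₂ r)) = ⊥-elim (braid-not-reduced sss≈ss r)
        where
        sss≈ss : (s' ∷ s ∷ s' ∷ s ∷ []) ≈W (s ∷ s' ∷ [])
        sss≈ss = wtrans (step (braid k2 s' s (→adj e)) [] [ s ]) (step (square s) (s ∷ s' ∷ []) [])

    -- k = 1, so {s, s'} are all the residues.  By induction on u, the pair
    -- σ u (lo s) < σ u (hi s) is an interval of consecutive positions
    -- starting at residue prev h, where h is the first letter of u ++ [ s ];
    -- v keeps each consecutive pair in order.
    module Infinite (e1 : prev s ≡ s') (e2 : prev s' ≡ s) where
      In : F → Set
      In t = t ≡ s ⊎ t ≡ s'

      next-in : ∀ {t} → In t → In (next t)
      next-in (inj₁ refl) = inj₂ (trans (sym (cong next e2)) (next-prev s'))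
      next-in (inj₂ refl) = inj₁ (trans (sym (cong next e1)) (next-prev s))

      prev-in : ∀ {t} → In t → In (prev t)
      prev-in (inj₁ refl) = inj₂ e1
      prev-in (inj₂ refl) = inj₁ e2

      prev-prev : ∀ {t} → In t → prev (prev t) ≡ t
      prev-prev (inj₁ refl) = trans (cong prev e1) e2
      prev-prev (inj₂ refl) = trans (cong prev e2) e1

      other-is-prev : ∀ {t h} → In t → In h → t ≢ h → t ≡ prev h
      other-is-prev (inj₁ refl) (inj₁ refl) ne = ⊥-elim (ne refl)
      other-is-prev (inj₁ refl) (inj₂ refl) ne = sym e2
      other-is-prev (inj₂ refl) (inj₁ refl) ne = sym e1
      other-is-prev (inj₂ refl) (inj₂ refl) ne = ⊥-elim (ne refl)

      consecutive : ∀ p → In (res p) → σ v p <P σ v (sucP p)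
      consecutive p (inj₁ x) = pos-at v s' p pv' (trans x (sym e2))
      consecutive p (inj₂ x) = pos-at v s p pv (trans x (sym e1))

      interval : ∀ d p → In (res p) → σ v p <P σ v (sucN (suc d) p)
      interval zero p ip = consecutive p ip
      interval (suc d) p ip =
        <P-trans (consecutive p ip)
          (subst (λ x → σ v (sucP p) <P σ v x) (sym (sucN-sucP (suc d) p))
            (interval d (sucP p) (subst In (sym (res-sucP p)) (next-in ip))))

      record Interval (u : Word) : Set where
        field
          h : F
          hin : In h
          rest : Word
          eh : u ++ [ s ] ≡ h ∷ rest
          ra : res (σ u (lo s)) ≡ prev h
          rb : res (σ u (hi s)) ≡ h
          d : ℕ
          eb : σ u (hi s) ≡ sucN (suc d) (σ u (lo s))

      interval-shape : ∀ u → IWord s s' u → Red (u ++ [ s ]) → Interval u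
      interval-shape [] iw red = record { h = s ; hin = inj₁ refl ; rest = [] ; eh = refl ; ra = refl ; rb = res-hi s ; d = 0 ; eb = refl }
      interval-shape (t ∷ u') (tin ∷ iw) red = record
          { h = t ; hin = tin ; rest = u' ++ [ s ] ; eh = refl
          ; ra = trans (cong res ea) (trans (res-predP a') (cong prev (trans ra' (sym tp))))
          ; rb = trans (cong res eb2) (trans (res-sucP b') (trans (cong next rb') (trans (cong next (sym (trans (cong prev tp) (prev-prev hin')))) (next-prev t))))
          ; d = suc (suc d')
          ; eb = trans eb2 (trans widened (cong (sucN (suc (suc (suc d')))) (sym ea)))
          }
        where
        open Interval (interval-shape u' iw (red-suffix [ t ] (u' ++ [ s ]) red))
          renaming (h to h'; hin to hin'; rest to rest'; eh to eh'; ra to ra'; rb to rb'; d to d'; eb to eb')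
        -- t differs from the first letter h' of u' ++ [ s ], hence t = prev h'
        tp : t ≡ prev h'
        tp = other-is-prev tin hin' λ x → red-sq [] rest' t (subst (λ y → Red (t ∷ y)) (trans eh' (cong (_∷ rest') (sym x))) red)
        a' b' : Pos
        a' = σ u' (lo s)
        b' = σ u' (hi s)
        ea : act t a' ≡ predP a'
        ea = act-hi t a' (trans ra' (sym tp))
        eb2 : act t b' ≡ sucP b'
        eb2 = act-lo t b' (trans rb' (trans (sym (prev-prev hin')) (cong prev (sym tp))))
        widened : sucP b' ≡ sucN (suc (suc (suc d'))) (predP a')
        widened = trans (cong sucP eb') (sym (trans (sucN-sucP (suc (suc d')) (predP a')) (cong (sucN (suc (suc d'))) (sucP-predP a'))))

      dih : ∀ u → IWord s s' u → Red (u ++ [ s ]) → Goal u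
      dih u iw red = subst (λ x → σ v (σ u (lo s)) <P σ v x) (sym eb)
                       (interval d (σ u (lo s)) (subst In (sym ra) (prev-in hin)))
        where open Interval (interval-shape u iw red)

    dihedral : ∀ u → IWord s s' u → Red (u ++ [ s ]) → Goal u
    dihedral u iw red with prev s ≟F s' | prev s' ≟F s
    ... | yes e1 | yes e2 = Infinite.dih e1 e2 u iw red
    ... | no n1 | yes e2 = BraidUp.dih e2 n1 u iw red
    ... | yes e1 | no n2 = BraidDown.dih e1 n2 u iw red
    ... | no n1 | no n2 = Commuting.dih n1 n2 u iw red


module Positivity (k' : ℕ) where
  -- Positivity of descents (Humphreys 5.4): if w ++ [ s ] is reduced, then w
  -- keeps the pair of s in order.  By induction on the length of w = w' s':
  -- choose a factorisation w ≈ v · u with u a word in s, s' and v as short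
  -- as possible (classically, which is harmless as the goal is decidable).
  -- Minimality makes v s and v s' reduced, so v keeps both pairs in order
  -- by induction, and the dihedral step concludes.

  open import Data.Nat as ℕ using (ℕ; zero; suc; _≤_; _<_; _+_)
  import Data.Nat.Properties as ℕP
  open import Relation.Binary.PropositionalEquality hiding ([_])
  open import Relation.Nullary using (¬_)
  open import Relation.Nullary.Decidable using (decidable-stable)
  open import Data.Empty using (⊥-elim)
  open import Data.Sum using (_⊎_; inj₁; inj₂)
  open import Data.Product using (_,_; ∃; _×_)
  open import Data.List using ([]; _∷_; _++_; length; [_])
  open import Data.List.Properties using (++-assoc; length-++)
  open import Data.List.Relation.Unary.All using (_∷_; [])
  open import Defs using (square; _≈W_; step) renaming (refl to wrefl; trans to wtrans)
  open Abacus k'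
  open Relations k'
  open Words k'
  open Order k'
  open Dihedral k'

  Least : (ℕ → Set) → ℕ → Set
  Least P m = P m × (∀ m' → m' < m → ¬ P m')

  ¬¬-least : (P : ℕ → Set) → ∀ {m₀} → P m₀ → ¬ ¬ ∃ (Least P)
  ¬¬-least P {m₀} p₀ no-least = below (suc m₀) m₀ (ℕP.n<1+n m₀) p₀
    where
    below : ∀ N m → m < N → ¬ P m
    below (suc N) m m<N pm = no-least (m , pm , λ m' m'<m → below N m' (ℕP.<-≤-trans m'<m (ℕ.s≤s⁻¹ m<N)))

  record Split (s s' : F) (w : Word) (m : ℕ) : Set where
    field
      v u : Word
      in-ss' : IWord s s' u
      equiv : (v ++ u) ≈W w
      length-v : length v ≡ m
      length-sum : length v + length u ≡ length w

  module LeastSplit {s s' w m} (red : Red (w ++ [ s ])) (sp : Split s s' w m)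
                    (least : ∀ m' → m' < m → ¬ Split s s' w m') where
    open Split sp public

    red-w : Red w
    red-w = red-prefix w [ s ] red

    red-tail : Red (u ++ [ s ])
    red-tail = red-suffix v (u ++ [ s ]) (subst Red (++-assoc v u [ s ]) red-vus)
      where
      red-vus : Red ((v ++ u) ++ [ s ])
      red-vus z z≈ = subst (_≤ length z) same-length (red z (wtrans z≈ (≈++ʳ [ s ] equiv)))
        where
        same-length : length (w ++ [ s ]) ≡ length ((v ++ u) ++ [ s ])
        same-length = trans (length-snoc w s) (trans (cong suc (sym (trans (length-++ v) length-sum))) (sym (length-snoc (v ++ u) s)))

    -- a shorter word z ≈ v x would give the shorter split w ≈ z ++ x ∷ u
    red-head : ∀ x → (x ≡ s ⊎ x ≡ s') → Red (v ++ [ x ])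
    red-head x x-in = red-snoc v x λ z z≈ → ℕP.≮⇒≥ λ z<v →
      least (length z) (subst (length z <_) length-v z<v) (shorter z z≈ z<v)
      where
      shorter : ∀ z → z ≈W (v ++ [ x ]) → length z < length v → Split s s' w (length z)
      shorter z z≈ z<v = record
        { v = z ; u = x ∷ u ; in-ss' = x-in ∷ in-ss' ; equiv = z-equiv ; length-v = refl
        ; length-sum = ℕP.≤-antisym
            (subst (_≤ length w) (sym (ℕP.+-suc (length z) (length u)))
              (subst (suc (length z) + length u ≤_) length-sum (ℕP.+-monoˡ-≤ (length u) z<v)))
            (subst (length w ≤_) (length-++ z) (red-w (z ++ x ∷ u) z-equiv))
        }
        where
        z-equiv : (z ++ x ∷ u) ≈W w
        z-equiv = wtrans (≈++ʳ (x ∷ u) z≈) (wtrans (≈subst (sym (++-assoc v [ x ] (x ∷ u))) refl (step (square x) v u)) equiv)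

    σ-split : ∀ p → σ v (σ u p) ≡ σ w p
    σ-split p = trans (sym (σ-++ v u p)) (σ-resp equiv p)

  positive : ∀ N (w : Word) s → length w ≤ N → Red (w ++ [ s ]) → Positive w s
  positive N w s lw red with snoc-view w
  ... | inj₁ refl = sucP-inc (lo s)
  positive zero w s lw red | inj₂ (w' , s' , refl) =
    ⊥-elim (ℕP.1+n≰n (ℕP.≤-trans (ℕP.≤-reflexive (sym (length-snoc w' s'))) (ℕP.≤-trans lw ℕ.z≤n)))
  positive (suc N) w s lw red | inj₂ (w' , s' , refl) =
    decidable-stable (<P-dec _ _) λ not-pos →
      ¬¬-least (Split s s' w) trivial-split λ { (m , sp , least) → not-pos (from-least m sp least) }
    where
    s≢s' : s ≢ s'
    s≢s' refl = red-sq w' [] s (subst Red (snoc² w' s s) red)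

    trivial-split : Split s s' w (length w')
    trivial-split = record { v = w' ; u = [ s' ] ; in-ss' = inj₂ refl ∷ [] ; equiv = wrefl
                           ; length-v = refl ; length-sum = sym (length-++ w') }

    from-least : ∀ m → Split s s' w m → (∀ m' → m' < m → ¬ Split s s' w m') → Positive w s
    from-least m sp least =
      subst₂ _<P_ (σ-split (lo s)) (σ-split (hi s))
        (Dih.dihedral s s' s≢s' v (positive N v s short (red-head s (inj₁ refl)))
                                  (positive N v s' short (red-head s' (inj₂ refl))) u in-ss' red-tail)
      where
      open LeastSplit red sp least
      short : length v ≤ N
      short = ℕP.≤-trans (subst (_≤ length w') (sym length-v) (ℕP.≮⇒≥ λ lt → least (length w') lt trivial-split))
                         (ℕ.s≤s⁻¹ (subst (_≤ suc N) (length-snoc w' s') lw))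

  positive-of-reduced : ∀ (w : Word) s → Red (w ++ [ s ]) → Positive w s
  positive-of-reduced w s = positive (length w) w s ℕP.≤-refl


module DiamondAction (k' : ℕ) where
  -- Link between the ⋄-action of Defs on V and the action on positions:
  -- (w ⋄ v)(res (σ w ⟨ 0 , j ⟩)) = v j + blk (σ w ⟨ 0 , j ⟩).  Testing this
  -- on the zero vector and on indicator vectors shows that a word x acting
  -- on V as t_α moves each position ⟨ B , j ⟩ to ⟨ B - α j , j ⟩.

  open import Data.Fin using (zero; suc; inject₁; fromℕ)
  open import Data.Fin.Properties using (toℕ-inject₁) renaming (_≟_ to _≟F_)
  import Data.Nat.Properties as ℕP
  open import Data.Integer using (ℤ; _+_; _-_; -_; 0ℤ; 1ℤ)
  import Data.Integer.Properties as ℤP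
  open import Data.Integer.Tactic.RingSolver using (solve-∀)
  open import Relation.Binary.PropositionalEquality
  open import Relation.Nullary using (Dec; yes; no; does; contradiction)
  open import Data.Empty using (⊥-elim)
  open import Data.Bool using (if_then_else_)
  open import Data.List using ([]; _∷_; reverse)
  open import Defs using (sAct; wAct; IsTranslation)
  open Abacus k'
  open Words k' using (σ-rev-l)

  V : Set
  V = F → ℤ

  stay : ∀ a b → a ≡ a + (b - b)
  stay = solve-∀

  sa0-last : ∀ (u : V) → sAct k zero u (fromℕ k) ≡ u zero - 1ℤ
  sa0-last u with fromℕ k' ≟F fromℕ k'
  ... | yes _ = refl
  ... | no ne = ⊥-elim (ne refl)

  sa0-oth : ∀ (u : V) r → r ≢ zero → r ≢ fromℕ k → sAct k zero u r ≡ u r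
  sa0-oth u r n1 n2 with r ≟F zero
  ... | yes e = ⊥-elim (n1 e)
  ... | no _ with r ≟F fromℕ k
  ...   | yes e = ⊥-elim (n2 e)
  ...   | no _ = refl

  sas-a : ∀ (u : V) i' → sAct k (suc i') u (inject₁ i') ≡ u (suc i')
  sas-a u i' with inject₁ i' ≟F inject₁ i'
  ... | yes _ = refl
  ... | no ne = ⊥-elim (ne refl)

  sas-b : ∀ (u : V) i' → sAct k (suc i') u (suc i') ≡ u (inject₁ i')
  sas-b u i' with suc i' ≟F inject₁ i'
  ... | yes e = ⊥-elim (ℕP.1+n≢n (trans (cong Data.Fin.toℕ e) (toℕ-inject₁ i')))
  ... | no _ with i' ≟F i'
  ...   | yes _ = refl
  ...   | no ne = ⊥-elim (ne refl)

  sas-oth : ∀ (u : V) i' r → r ≢ inject₁ i' → r ≢ suc i' → sAct k (suc i') u r ≡ u r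
  sas-oth u i' r n1 n2 with r ≟F inject₁ i'
  ... | yes e = ⊥-elim (n1 e)
  ... | no _ with r ≟F suc i'
  ...   | yes e = ⊥-elim (n2 e)
  ...   | no _ = refl

  link-letter : ∀ i (u : V) p → sAct k i u (res (act i p)) ≡ u (res p) + (blk (act i p) - blk p)
  link-letter zero u ⟨ B , r ⟩ = by-cases (r ≟F fromℕ k) (r ≟F zero)
    where
    p : Pos
    p = ⟨ B , r ⟩
    by-cases : Dec (r ≡ fromℕ k) → Dec (r ≡ zero) → sAct k zero u (res (act zero p)) ≡ u r + (blk (act zero p) - B)
    by-cases (yes refl) _ rewrite act-lo zero p refl | sucP-last B = up (u (fromℕ k)) B
      where up : ∀ a b → a + 1ℤ ≡ a + (b + 1ℤ - b)
            up = solve-∀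
    by-cases (no n1) (yes refl) rewrite act-hi zero p refl = trans (sa0-last u) (down (u zero) B)
      where down : ∀ a b → a - 1ℤ ≡ a + (b - 1ℤ - b)
            down = solve-∀
    by-cases (no n1) (no n2) rewrite act-oth zero p n1 n2 = trans (sa0-oth u r n2 n1) (stay (u r) B)
  link-letter (suc i') u ⟨ B , r ⟩ = by-cases (r ≟F inject₁ i') (r ≟F suc i')
    where
    p : Pos
    p = ⟨ B , r ⟩
    by-cases : Dec (r ≡ inject₁ i') → Dec (r ≡ suc i') → sAct k (suc i') u (res (act (suc i') p)) ≡ u r + (blk (act (suc i') p) - B)
    by-cases (yes refl) _ rewrite act-lo (suc i') p refl | sucP-inject₁ B i' = trans (sas-b u i') (stay (u (inject₁ i')) B)
    by-cases (no n1) (yes refl) rewrite act-hi (suc i') p refl = trans (sas-a u i') (stay (u (suc i')) B)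
    by-cases (no n1) (no n2) rewrite act-oth (suc i') p n1 n2 = trans (sas-oth u i' r n1 n2) (stay (u r) B)

  link : ∀ (w : Word) (v : V) j → wAct k w v (res (σ w ⟨ 0ℤ , j ⟩)) ≡ v j + blk (σ w ⟨ 0ℤ , j ⟩)
  link [] v j = sym (ℤP.+-identityʳ (v j))
  link (i ∷ w) v j =
    trans (link-letter i (wAct k w v) p)
      (trans (cong (_+ (blk (act i p) - blk p)) (link w v j)) (telescope (v j) (blk p) (blk (act i p))))
    where
    p : Pos
    p = σ w ⟨ 0ℤ , j ⟩
    telescope : ∀ a b c → a + b + (c - b) ≡ a + c
    telescope = solve-∀

  module Trans (x : Word) (α : V) (tr : IsTranslation k x α) where
    -- x moves ⟨ 0 , j ⟩ to ⟨ - α j , j ⟩: by link, v (res q) - α (res q) = v j + blk q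
    -- for all v, where q = σ x ⟨ 0 , j ⟩; take v = 0, then v = indicator of j.
    σx0 : ∀ j → σ x ⟨ 0ℤ , j ⟩ ≡ ⟨ - α j , j ⟩
    σx0 j = cong₂ ⟨_,_⟩ (trans blk-q (cong (λ t → - α t) res-q)) res-q
      where
      q : Pos
      q = σ x ⟨ 0ℤ , j ⟩
      key : ∀ v → v (res q) - α (res q) ≡ v j + blk q
      key v = trans (sym (tr v (res q))) (link x v j)
      blk-q : blk q ≡ - α (res q)
      blk-q = trans (sym (ℤP.+-identityˡ (blk q))) (trans (sym (key (λ _ → 0ℤ))) (ℤP.+-identityˡ (- α (res q))))
      δ : V
      δ t = if does (t ≟F j) then 1ℤ else 0ℤ
      res-q : res q ≡ j
      res-q with res q ≟F j | key δ
      ... | yes e | _ = e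
      ... | no ne | e with j ≟F j
      ...   | no n = ⊥-elim (n refl)
      ...   | yes _ rewrite blk-q = ⊥-elim (0≢1 (α (res q)) e)
        where
        0≢1 : ∀ a → 0ℤ - a ≢ 1ℤ + - a
        0≢1 a e = contradiction (trans (sym (+a a)) (trans (cong (_+ a) e) (1+a a))) (λ ())
          where
          +a : ∀ a → 0ℤ - a + a ≡ 0ℤ
          +a = solve-∀
          1+a : ∀ a → 1ℤ + - a + a ≡ 1ℤ
          1+a = solve-∀

    σx : ∀ B j → σ x ⟨ B , j ⟩ ≡ ⟨ - α j + B , j ⟩
    σx B j = trans (cong (σ x) (cong ⟨_, j ⟩ (sym (ℤP.+-identityˡ B)))) (trans (σ-shift x B ⟨ 0ℤ , j ⟩) (cong (shift B) (σx0 j)))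

    σrx : ∀ B j → σ (reverse x) ⟨ B , j ⟩ ≡ ⟨ B + α j , j ⟩
    σrx B j = trans (cong (σ (reverse x)) (sym moved)) (σ-rev-l x ⟨ B + α j , j ⟩)
      where
      cancel : ∀ a B → - a + (B + a) ≡ B
      cancel = solve-∀
      moved : σ x ⟨ B + α j , j ⟩ ≡ ⟨ B , j ⟩
      moved = trans (σx (B + α j) j) (cong ⟨_, j ⟩ (cancel (α j) B))


module Maya (k' : ℕ) where
  -- The box ending row r of a partition
  -- whose r-th part is ℓ sits at the position mp ℓ r, the integer ℓ - r;
  -- a box of content i is added to that row by moving this bead from
  -- mp ℓ r to mp (suc ℓ) r, whose residue is i exactly when
  -- (ℓ + 1) - r ≡ i mod n.

  open import Data.Nat as ℕ using (ℕ; zero; suc; _+_; _*_; _≤_; _<_; _<ᵇ_; _≡ᵇ_)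
  import Data.Nat.Properties as ℕP
  open import Data.Nat.DivMod using (_%_; %-distribˡ-+; m%n%n≡m%n; [m+n]%n≡m%n; m<n⇒m%n≡m)
  open import Data.Fin using (zero; suc; toℕ)
  open import Data.Fin.Properties using (toℕ-inject₁; toℕ-fromℕ; toℕ<n)
  open import Data.Integer using (0ℤ)
  open import Relation.Binary.PropositionalEquality
  open import Relation.Nullary using (¬_)
  open import Data.Unit using (⊤; tt)
  open import Data.Sum using (_⊎_; inj₁; inj₂)
  open import Data.Product using (_,_; ∃; _×_)
  open import Data.Bool using (true; false; _∧_; T)
  open import Data.Maybe using (Maybe; just; nothing)
  open import Data.List using (List; []; _∷_)
  open import Defs using (addableAfter)
  open Cyclic
  open Abacus k'
  open Order k'

  origin : Pos
  origin = ⟨ 0ℤ , zero ⟩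

  mp : ℕ → ℕ → Pos
  mp ℓ r = sucN ℓ (predN r origin)

  mp-suc-r : ∀ ℓ r → mp ℓ (suc r) ≡ predP (mp ℓ r)
  mp-suc-r ℓ r = sucN-predP ℓ (predN r origin)

  n : ℕ
  n = suc k

  %-absorbˡ : ∀ a b → (a % n + b) % n ≡ (a + b) % n
  %-absorbˡ a b = trans (%-distribˡ-+ (a % n) b n) (trans (cong (λ x → (x + b % n) % n) (m%n%n≡m%n a n)) (sym (%-distribˡ-+ a b n)))

  %-absorbʳ : ∀ c a → (c + a % n) % n ≡ (c + a) % n
  %-absorbʳ c a = trans (cong (_% n) (ℕP.+-comm c (a % n))) (trans (%-absorbˡ a c) (cong (_% n) (ℕP.+-comm a c)))

  toℕ-res-predP : ∀ p → toℕ (res (predP p)) ≡ (toℕ (res p) + k) % n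
  toℕ-res-predP ⟨ B , zero ⟩ = trans (toℕ-fromℕ k) (sym (m<n⇒m%n≡m (ℕP.n<1+n k)))
  toℕ-res-predP ⟨ B , suc j ⟩ =
    trans (toℕ-inject₁ j) (sym (trans (cong (_% n) (sym (ℕP.+-suc (toℕ j) k)))
                                 (trans ([m+n]%n≡m%n (toℕ j) n) (m<n⇒m%n≡m (ℕP.<-trans (toℕ<n j) (ℕP.n<1+n k))))))

  res-predN : ∀ r → toℕ (res (predN r origin)) ≡ (r * k) % n
  res-predN zero = refl
  res-predN (suc r) =
    trans (toℕ-res-predP (predN r origin))
      (trans (cong (λ x → (x + k) % n) (res-predN r)) (trans (%-absorbˡ (r * k) k) (cong (_% n) (ℕP.+-comm (r * k) k))))

  res-sucN : ∀ c p → toℕ (res (sucN c p)) ≡ (c + toℕ (res p)) % n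
  res-sucN zero p = sym (m<n⇒m%n≡m (toℕ<n (res p)))
  res-sucN (suc c) p =
    trans (cong toℕ (res-sucP (sucN c p))) (trans (toℕ-next (res (sucN c p))) (trans (cong (λ x → suc x % n) (res-sucN c p))
      (trans (cong (_% n) (ℕP.+-comm 1 ((c + toℕ (res p)) % n))) (trans (%-absorbˡ (c + toℕ (res p)) 1) (cong (_% n) (ℕP.+-comm (c + toℕ (res p)) 1))))))

  -- the residue of mp c r is the content (c - r) mod n = (c + k·r) mod n
  res-mp : ∀ c r → toℕ (res (mp c r)) ≡ (c + k * r) % n
  res-mp c r =
    trans (res-sucN c (predN r origin))
      (trans (cong (λ x → (c + x) % n) (res-predN r)) (trans (%-absorbʳ c (r * k)) (cong (λ x → (c + x) % n) (ℕP.*-comm r k))))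

  T-false : ¬ T false
  T-false ()

  ≡ᵇ-true : ∀ x y → (x ≡ᵇ y) ≡ true → x ≡ y
  ≡ᵇ-true x y e = ℕP.≡ᵇ⇒≡ x y (subst T (sym e) tt)

  ≡ᵇ-false : ∀ x y → (x ≡ᵇ y) ≡ false → x ≢ y
  ≡ᵇ-false x y e refl = T-false (subst T e (ℕP.≡⇒≡ᵇ x x refl))

  <ᵇ-true : ∀ x y → (x <ᵇ y) ≡ true → x < y
  <ᵇ-true x y e = ℕP.<ᵇ⇒< x y (subst T (sym e) tt)

  <ᵇ-false : ∀ x y → (x <ᵇ y) ≡ false → ¬ (x < y)
  <ᵇ-false x y e lt = T-false (subst T e (ℕP.<⇒<ᵇ lt))

  ∧-true : ∀ {a b} → (a ∧ b) ≡ true → a ≡ true × b ≡ true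
  ∧-true {true} {true} _ = refl , refl

  ∧-false : ∀ {a b} → (a ∧ b) ≡ false → a ≡ false ⊎ b ≡ false
  ∧-false {false} _ = inj₁ refl
  ∧-false {true} {false} _ = inj₂ refl

  -- The Maya diagram (set of beads) of the rows λs, numbered from r on:
  -- one bead mp ℓ r' per row r' of length ℓ, followed by the tail of all
  -- positions at or below mp 0 r'' for the first missing row r''.
  TailBead : ℕ → Pos → Set
  TailBead r q = ∃ λ d → q ≡ predN d (mp 0 r)

  Bead : ℕ → List ℕ → Pos → Set
  Bead r [] q = TailBead r q
  Bead r (ℓ ∷ λs) q = q ≡ mp ℓ r ⊎ Bead (suc r) λs q

  Bound : Maybe ℕ → ℕ → Set
  Bound nothing _ = ⊤
  Bound (just m) ℓ = ℓ ≤ m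

  Partition : Maybe ℕ → List ℕ → Set
  Partition p [] = ⊤
  Partition p (ℓ ∷ λs) = 1 ≤ ℓ × Bound p ℓ × Partition (just ℓ) λs

  PrevNonzero : Maybe ℕ → Set
  PrevNonzero nothing = ⊤
  PrevNonzero (just m) = 1 ≤ m

  NotPrevBead : Maybe ℕ → ℕ → Pos → Set
  NotPrevBead nothing r₀ q = ⊤
  NotPrevBead (just m) r₀ q = q ≢ mp m r₀

  mp-step : ∀ ℓ r → mp ℓ (suc r) <P mp ℓ r
  mp-step ℓ r = subst (_<P mp ℓ r) (sym (mp-suc-r ℓ r)) (predP-dec (mp ℓ r))

  sucP-mp : ∀ m r → sucP (mp m (suc r)) ≡ mp m r
  sucP-mp m r = trans (cong sucP (mp-suc-r m r)) (sucP-predP (mp m r))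

  tail-below : ∀ {r q} → TailBead r q → q ≤P mp 0 r
  tail-below {r} (d , refl) = predN-le d (mp 0 r)

  below-prev : ∀ r₀ m λs q → Partition (just m) λs → Bead (suc r₀) λs q → q <P mp m r₀
  below-prev r₀ m [] q _ t = ≤<-trans (tail-below {suc r₀} t) (<≤-trans (mp-step 0 r₀) (sucN-le {0} {m} ℕ.z≤n (predN r₀ origin)))
  below-prev r₀ m (ℓ ∷ λs) q (_ , ℓ≤m , _) (inj₁ refl) = <≤-trans (mp-step ℓ r₀) (sucN-le ℓ≤m (predN r₀ origin))
  below-prev r₀ m (ℓ ∷ λs) q (_ , ℓ≤m , pt) (inj₂ x) =
    <P-trans (below-prev (suc r₀) ℓ λs q pt x) (<≤-trans (mp-step ℓ r₀) (sucN-le ℓ≤m (predN r₀ origin)))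

  bead-below : ∀ r₀ ℓ λs q → Partition (just ℓ) λs → Bead (suc r₀) (ℓ ∷ λs) q → q ≤P mp ℓ (suc r₀)
  bead-below r₀ ℓ λs q pt (inj₁ refl) = inj₁ refl
  bead-below r₀ ℓ λs q pt (inj₂ x) = inj₂ (below-prev (suc r₀) ℓ λs q pt x)

  notPrev-tail : ∀ r₀ p → PrevNonzero p → NotPrevBead p r₀ (sucP (mp 0 (suc r₀)))
  notPrev-tail r₀ nothing _ = tt
  notPrev-tail r₀ (just (suc m')) _ e with sucN-injective {1} {suc (suc m')} (predN (suc r₀) origin) (trans e (sym (sucP-mp (suc m') r₀)))
  ... | ()

  addable-tail : ∀ p → PrevNonzero p → addableAfter p 0 ≡ true
  addable-tail nothing _ = refl
  addable-tail (just (suc m')) _ = refl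

  bound-one : ∀ p → PrevNonzero p → Bound p 1
  bound-one nothing _ = tt
  bound-one (just m) x = x

  notPrev-below : ∀ r₀ p ℓ λs₀ → Partition p (ℓ ∷ λs₀) → ∀ q → q ≤P mp ℓ (suc r₀) → NotPrevBead p r₀ q
  notPrev-below r₀ nothing ℓ λs₀ _ q _ = tt
  notPrev-below r₀ (just m) ℓ λs₀ pt q le e =
    ≤<-irr (subst (_≤P mp ℓ (suc r₀)) e le) (below-prev r₀ m (ℓ ∷ λs₀) (mp ℓ (suc r₀)) pt (inj₁ refl))

  notPrev-addable : ∀ r₀ p ℓ → addableAfter p ℓ ≡ true → NotPrevBead p r₀ (sucP (mp ℓ (suc r₀)))
  notPrev-addable r₀ nothing ℓ _ = tt
  notPrev-addable r₀ (just m) ℓ e eq =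
    ℕP.<-irrefl (ℕP.suc-injective (sucN-injective (predN (suc r₀) origin) (trans eq (sym (sucP-mp m r₀))))) (<ᵇ-true ℓ m e)

  prev-blocks : ∀ r₀ p ℓ → Bound p ℓ → addableAfter p ℓ ≡ false → ¬ NotPrevBead p r₀ (sucP (mp ℓ (suc r₀)))
  prev-blocks r₀ nothing ℓ _ () _
  prev-blocks r₀ (just m) ℓ bd e nt with ℕP.m≤n⇒m<n∨m≡n bd
  ... | inj₁ lt = <ᵇ-false ℓ m e lt
  ... | inj₂ refl = nt (sucP-mp ℓ r₀)

  bound-suc : ∀ p ℓ → addableAfter p ℓ ≡ true → Bound p (suc ℓ)
  bound-suc nothing ℓ _ = tt
  bound-suc (just m) ℓ e = <ᵇ-true ℓ m e

  bound-weaken : ∀ ℓ xs → Partition (just ℓ) xs → Partition (just (suc ℓ)) xs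
  bound-weaken ℓ [] _ = tt
  bound-weaken ℓ (x ∷ xs) (a , b , c) = a , ℕP.m≤n⇒m≤1+n b , c


module AddBoxes (k' : ℕ) (i : Fin (suc (suc k'))) where
  -- Adding every addable box of
  -- content i (the function addAll of Defs) moves every bead y with
  -- res (sucP y) ≡ i and sucP y free one step up; the flag reports
  -- whether some bead moved.  This is proved by induction along the rows,
  -- for the rows from r₀ + 1 on, below a previous row of length p.

  open import Data.Nat as ℕ using (ℕ; zero; suc; _≤_)
  open import Data.Fin using (toℕ)
  open import Data.Fin.Properties using (toℕ-injective)
  open import Relation.Binary.PropositionalEquality
  open import Relation.Nullary using (¬_)
  open import Data.Empty using (⊥-elim)
  open import Data.Unit using (tt)
  open import Data.Sum using (_⊎_; inj₁; inj₂)
  open import Data.Product using (_,_; ∃; _×_; proj₁; proj₂)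
  open import Data.Bool using (Bool; true; false; _∧_)
  open import Data.Maybe using (Maybe; just)
  open import Data.List using (List; []; _∷_)
  open import Defs using (addAll; addableAfter; contentIs)
  open Abacus k'
  open Order k'
  open Maya k'

  content-t : ∀ r c → contentIs k i r c ≡ true → res (mp c r) ≡ i
  content-t r c e = toℕ-injective (trans (res-mp c r) (≡ᵇ-true _ _ e))

  content-f : ∀ r c → contentIs k i r c ≡ false → res (mp c r) ≢ i
  content-f r c e x = ≡ᵇ-false _ _ e (trans (sym (res-mp c r)) (cong toℕ x))

  Movable : ℕ → Maybe ℕ → List ℕ → Pos → Set
  Movable r₀ p λs y = res (sucP y) ≡ i × ¬ Bead (suc r₀) λs (sucP y) × NotPrevBead p r₀ (sucP y)

  AfterMove : ℕ → Maybe ℕ → List ℕ → Pos → Set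
  AfterMove r₀ p λs q = (Bead (suc r₀) λs q × ¬ Movable r₀ p λs q) ⊎ (∃ λ y → Bead (suc r₀) λs y × Movable r₀ p λs y × q ≡ sucP y)

  record AddAllSpec (r₀ : ℕ) (p : Maybe ℕ) (λs : List ℕ) (out : List ℕ × Bool) : Set where
    field
      sound : ∀ q → Bead (suc r₀) (proj₁ out) q → AfterMove r₀ p λs q
      complete : ∀ q → AfterMove r₀ p λs q → Bead (suc r₀) (proj₁ out) q
      flag : ∀ y → Bead (suc r₀) λs y → Movable r₀ p λs y → proj₂ out ≡ true
      shape : Partition p (proj₁ out)

  -- no rows left: only the top bead of the tail can move, to form a row of length 1
  module Tail (r₀ : ℕ) (p : Maybe ℕ) (pt : PrevNonzero p) where
    top : Pos
    top = mp 0 (suc r₀)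

    tail-movable : ∀ y → TailBead (suc r₀) y → Movable r₀ p [] y → y ≡ top
    tail-movable y (zero , e) _ = e
    tail-movable y (suc d , refl) (_ , nm , _) = ⊥-elim (nm (d , sucP-predP (predN d top)))

    above-top-free : ¬ TailBead (suc r₀) (sucP top)
    above-top-free t = ≤<-irr (tail-below {suc r₀} t) (sucP-inc top)

    above-top-notPrev : NotPrevBead p r₀ (sucP top)
    above-top-notPrev = notPrev-tail r₀ p pt

    tail-shift : ∀ d → predN d (mp 0 (suc (suc r₀))) ≡ predN (suc d) top
    tail-shift d = predN-predP d top

    addAll-tail : AddAllSpec r₀ p [] (addAll k i (suc r₀) p [])
    addAll-tail rewrite addable-tail p pt with contentIs k i (suc r₀) 1 in ec
    ... | true = record { sound = sound ; complete = complete ; flag = λ _ _ _ → refl ; shape = ℕ.s≤s ℕ.z≤n , bound-one p pt , tt }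
      where
      top-movable : Movable r₀ p [] top
      top-movable = content-t (suc r₀) 1 ec , above-top-free , above-top-notPrev
      sound : ∀ q → Bead (suc r₀) (1 ∷ []) q → AfterMove r₀ p [] q
      sound q (inj₁ refl) = inj₂ (top , (0 , refl) , top-movable , refl)
      sound q (inj₂ (d , refl)) =
        inj₁ ((suc d , tail-shift d) , λ { (_ , nm , _) → nm (d , subst (λ x → sucP x ≡ predN d top) (sym (tail-shift d)) (sucP-predP (predN d top))) })
      complete : ∀ q → AfterMove r₀ p [] q → Bead (suc r₀) (1 ∷ []) q
      complete q (inj₁ ((zero , refl) , nu)) = ⊥-elim (nu top-movable)
      complete q (inj₁ ((suc d , refl) , nu)) = inj₂ (d , sym (tail-shift d))
      complete q (inj₂ (y , ty , up , refl)) = inj₁ (cong sucP (tail-movable y ty up))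
    ... | false = record { sound = sound ; complete = complete ; flag = λ y ty up → ⊥-elim (none-movable y ty up) ; shape = tt }
      where
      none-movable : ∀ y → TailBead (suc r₀) y → ¬ Movable r₀ p [] y
      none-movable y ty up = content-f (suc r₀) 1 ec (subst (λ x → res (sucP x) ≡ i) (tail-movable y ty up) (proj₁ up))
      sound : ∀ q → Bead (suc r₀) [] q → AfterMove r₀ p [] q
      sound q t = inj₁ (t , none-movable q t)
      complete : ∀ q → AfterMove r₀ p [] q → Bead (suc r₀) [] q
      complete q (inj₁ (t , _)) = t
      complete q (inj₂ (y , ty , up , _)) = ⊥-elim (none-movable y ty up)

  module Row (r₀ : ℕ) (p : Maybe ℕ) (ℓ : ℕ) (λs₀ : List ℕ) (1≤ℓ : 1 ≤ ℓ) (bd : Bound p ℓ) (pt₀ : Partition (just ℓ) λs₀) where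
    rowBead : Pos
    rowBead = mp ℓ (suc r₀)
    partR : Partition p (ℓ ∷ λs₀)
    partR = 1≤ℓ , bd , pt₀
    BeadBelow MovableHere MovableBelow : Pos → Set
    BeadBelow = Bead (suc (suc r₀)) λs₀
    MovableHere = Movable r₀ p (ℓ ∷ λs₀)
    MovableBelow = Movable (suc r₀) (just ℓ) λs₀

    below-row : ∀ y → BeadBelow y → y <P rowBead
    below-row y m = below-prev (suc r₀) ℓ λs₀ y pt₀ m

    movable-lift : ∀ y → BeadBelow y → MovableBelow y → MovableHere y
    movable-lift y m (r , nm , nt) = r , (λ { (inj₁ e) → nt e ; (inj₂ x) → nm x }) , notPrev-below r₀ p ℓ λs₀ partR (sucP y) (discrete (below-row y m))

    movable-drop : ∀ y → MovableHere y → MovableBelow y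
    movable-drop y (r , nm , _) = r , (λ x → nm (inj₂ x)) , (λ e → nm (inj₁ e))

    above-not-bead : ¬ Bead (suc r₀) (ℓ ∷ λs₀) (sucP rowBead)
    above-not-bead x = ≤<-irr (bead-below r₀ ℓ λs₀ (sucP rowBead) pt₀ x) (sucP-inc rowBead)

    after-lift : ∀ q → AfterMove (suc r₀) (just ℓ) λs₀ q → AfterMove r₀ p (ℓ ∷ λs₀) q
    after-lift q (inj₁ (m , nu)) = inj₁ (inj₂ m , λ up → nu (movable-drop q up))
    after-lift q (inj₂ (y , m , up , e)) = inj₂ (y , inj₂ m , movable-lift y m up , e)

    addHere : Bool
    addHere = addableAfter p ℓ ∧ contentIs k i (suc r₀) (suc ℓ)

    movable-here : addHere ≡ true → MovableHere rowBead
    movable-here e with ∧-true {addableAfter p ℓ} e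
    ... | ea , ec = content-t (suc r₀) (suc ℓ) ec , above-not-bead , notPrev-addable r₀ p ℓ ea

    not-movable-here : addHere ≡ false → ¬ MovableHere rowBead
    not-movable-here e (r , _ , nt) with ∧-false {addableAfter p ℓ} e
    ... | inj₁ ea = prev-blocks r₀ p ℓ bd ea nt
    ... | inj₂ ec = content-f (suc r₀) (suc ℓ) ec r

    module _ (λs₀' : List ℕ) (b₀ : Bool) (IH : AddAllSpec (suc r₀) (just ℓ) λs₀ (λs₀' , b₀)) where
      open AddAllSpec IH renaming (sound to sound₁; complete to complete₁; flag to flag₁; shape to partition₁)

      added : addHere ≡ true → AddAllSpec r₀ p (ℓ ∷ λs₀) (suc ℓ ∷ λs₀' , true)
      added ec = record
        { sound = sound ; complete = complete ; flag = λ _ _ _ → refl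
        ; shape = ℕ.s≤s ℕ.z≤n , bound-suc p ℓ (proj₁ (∧-true {addableAfter p ℓ} ec)) , bound-weaken ℓ λs₀' partition₁ }
        where
        up : MovableHere rowBead
        up = movable-here ec
        sound : ∀ q → Bead (suc r₀) (suc ℓ ∷ λs₀') q → AfterMove r₀ p (ℓ ∷ λs₀) q
        sound q (inj₁ refl) = inj₂ (rowBead , inj₁ refl , up , refl)
        sound q (inj₂ m) = after-lift q (sound₁ q m)
        complete : ∀ q → AfterMove r₀ p (ℓ ∷ λs₀) q → Bead (suc r₀) (suc ℓ ∷ λs₀') q
        complete q (inj₁ (inj₁ refl , nu)) = ⊥-elim (nu up)
        complete q (inj₁ (inj₂ m , nu)) = inj₂ (complete₁ q (inj₁ (m , λ u1 → nu (movable-lift q m u1))))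
        complete q (inj₂ (y , inj₁ refl , _ , refl)) = inj₁ refl
        complete q (inj₂ (y , inj₂ m , u , e)) = inj₂ (complete₁ q (inj₂ (y , m , movable-drop y u , e)))

      not-added : addHere ≡ false → AddAllSpec r₀ p (ℓ ∷ λs₀) (ℓ ∷ λs₀' , b₀)
      not-added ec = record { sound = sound ; complete = complete ; flag = flag ; shape = 1≤ℓ , bd , partition₁ }
        where
        nup : ¬ MovableHere rowBead
        nup = not-movable-here ec
        sound : ∀ q → Bead (suc r₀) (ℓ ∷ λs₀') q → AfterMove r₀ p (ℓ ∷ λs₀) q
        sound q (inj₁ refl) = inj₁ (inj₁ refl , nup)
        sound q (inj₂ m) = after-lift q (sound₁ q m)
        complete : ∀ q → AfterMove r₀ p (ℓ ∷ λs₀) q → Bead (suc r₀) (ℓ ∷ λs₀') q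
        complete q (inj₁ (inj₁ e , _)) = inj₁ e
        complete q (inj₁ (inj₂ m , nu)) = inj₂ (complete₁ q (inj₁ (m , λ u1 → nu (movable-lift q m u1))))
        complete q (inj₂ (y , inj₁ refl , u , _)) = ⊥-elim (nup u)
        complete q (inj₂ (y , inj₂ m , u , e)) = inj₂ (complete₁ q (inj₂ (y , m , movable-drop y u , e)))
        flag : ∀ y → Bead (suc r₀) (ℓ ∷ λs₀) y → MovableHere y → b₀ ≡ true
        flag y (inj₁ refl) u = ⊥-elim (nup u)
        flag y (inj₂ m) u = flag₁ y m (movable-drop y u)

  addAll-spec : ∀ r₀ p λs → PrevNonzero p → Partition p λs → AddAllSpec r₀ p λs (addAll k i (suc r₀) p λs)
  addAll-spec r₀ p [] pt _ = Tail.addAll-tail r₀ p pt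
  addAll-spec r₀ p (ℓ ∷ λs₀) pt (1≤ℓ , bd , pt₀) with addAll k i (suc (suc r₀)) (just ℓ) λs₀ | addAll-spec (suc r₀) (just ℓ) λs₀ 1≤ℓ pt₀
  ... | (λs₀' , b₀) | IH with addableAfter p ℓ ∧ contentIs k i (suc r₀) (suc ℓ) in ec
  ...   | true = Row.added r₀ p ℓ λs₀ 1≤ℓ bd pt₀ λs₀' b₀ IH ec
  ...   | false = Row.not-added r₀ p ℓ λs₀ 1≤ℓ bd pt₀ λs₀' b₀ IH ec


module Cores (k' : ℕ) where
  -- For a word w let ρ = σ (reverse w), the action
  -- of w⁻¹; then ρ⁻¹(positions of negative block) is the Maya diagram of the
  -- core w·∅.  Applying u_i
  -- to ν is nonzero, and keeps the invariant for ρ ∘ s_i, whenever ρ keeps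
  -- the pair of i in order (an up step).  Hence uWord w ∅ ≠ 0 as soon as
  -- every letter of w is applied in an up step.

  open import Data.Nat as ℕ using (ℕ; zero; suc; _+_; _*_)
  import Data.Nat.Properties as ℕP
  open import Data.Fin using (zero; suc; toℕ; fromℕ; inject₁)
  open import Data.Fin.Properties using (toℕ-injective; toℕ-fromℕ; toℕ-inject₁; toℕ<n) renaming (_≟_ to _≟F_)
  open import Data.Integer as ℤ using (-_; +_; 0ℤ; 1ℤ; -1ℤ; -[1+_]) renaming (_+_ to _+ℤ_; _-_ to _-ℤ_; _<_ to _<ℤ_)
  import Data.Integer.Properties as ℤP
  open import Data.Integer.Tactic.RingSolver using (solve-∀)
  open import Relation.Binary.PropositionalEquality hiding ([_])
  open import Relation.Nullary using (¬_; Dec; yes; no)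
  open import Data.Empty using (⊥; ⊥-elim)
  open import Data.Unit using (tt)
  open import Data.Sum using (inj₁; inj₂)
  open import Data.Product using (_,_; ∃; _×_; proj₁; proj₂)
  open import Data.Bool using (true; false)
  open import Data.Maybe using (just; nothing; _>>=_)
  open import Data.List using (List; []; _∷_; _++_; reverse; [_])
  open import Data.List.Properties using (unfold-reverse)
  open import Defs using (addAll; uAct; uWord)
  open Cyclic
  open Abacus k'
  open Order k'
  open Maya k'

  -- The empty partition: its Maya diagram, the tail below mp 0 1, is the set
  -- of positions of negative block.
  reach-last : ∀ d (r : F) B → d + toℕ r ≡ k → sucN d ⟨ B , r ⟩ ≡ ⟨ B , fromℕ k ⟩
  reach-last zero r B e = cong ⟨ B ,_⟩ (toℕ-injective (trans e (sym (toℕ-fromℕ k))))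
  reach-last (suc d) r B e with split r
  ... | inj₁ refl = ⊥-elim (ℕP.m≢1+n+m k (sym (trans (cong (λ x → suc (d + x)) (sym (toℕ-fromℕ k))) e)))
  ... | inj₂ (j , refl) =
    trans (sucN-sucP d ⟨ B , inject₁ j ⟩)
      (trans (cong (sucN d) (sucP-inject₁ B j))
        (reach-last d (suc j) B (trans (ℕP.+-suc d (toℕ j)) (trans (cong (λ x → suc (d + x)) (sym (toℕ-inject₁ j))) e))))

  from-last : ∀ (r : F) B → ∃ λ j → predN j ⟨ B , fromℕ k ⟩ ≡ ⟨ B , r ⟩
  from-last r B = d , trans (cong (predN d) (sym (reach-last d r B (ℕP.m∸n+n≡m (ℕ.s≤s⁻¹ (toℕ<n r)))))) (predN-sucN d ⟨ B , r ⟩)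
    where
    d : ℕ
    d = k ℕ.∸ toℕ r

  predN-block : ∀ B → predN (suc k) ⟨ B , fromℕ k ⟩ ≡ ⟨ B -ℤ 1ℤ , fromℕ k ⟩
  predN-block B = trans (cong (predN (suc k)) (sym (reach-last k zero B (ℕP.+-identityʳ k)))) (cong predP (predN-sucN k ⟨ B , zero ⟩))

  negative-blocks : ∀ c → ⟨ -[1+ c ] , fromℕ k ⟩ ≡ predN (c * suc k) ⟨ -1ℤ , fromℕ k ⟩
  negative-blocks zero = refl
  negative-blocks (suc c) =
    trans (cong ⟨_, fromℕ k ⟩ (sym (cong (λ x → -[1+ suc x ]) (ℕP.+-identityʳ c))))
      (trans (sym (predN-block -[1+ c ]))
        (trans (cong (predN (suc k)) (negative-blocks c)) (sym (predN-+ (suc k) (c * suc k) _))))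

  negative⇒tail : ∀ q → blk q <ℤ 0ℤ → ∃ λ d → q ≡ predN d (predN 1 origin)
  negative⇒tail ⟨ + n , r ⟩ (ℤ.+<+ ())
  negative⇒tail ⟨ -[1+ c ] , r ⟩ _ with from-last r -[1+ c ]
  ... | j , e = (j + c * suc k) , trans (sym e) (trans (cong (predN j) (negative-blocks c)) (sym (predN-+ j (c * suc k) _)))

  tail⇒negative : ∀ q d → q ≡ predN d (predN 1 origin) → blk q <ℤ 0ℤ
  tail⇒negative q d refl with predN-le d ⟨ -1ℤ , fromℕ k ⟩
  ... | inj₁ e = subst (λ x → blk x <ℤ 0ℤ) (sym e) (ℤ.-<+)
  ... | inj₂ (inj₁ l) = ℤP.<-trans l ℤ.-<+
  ... | inj₂ (inj₂ (e , _)) = subst (_<ℤ 0ℤ) (sym e) ℤ.-<+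

  Negative : (Pos → Pos) → Pos → Set
  Negative ρ q = blk (ρ q) <ℤ 0ℤ

  Represents : List ℕ → (Pos → Pos) → Set
  Represents ν ρ = Partition nothing ν × (∀ q → Bead 1 ν q → Negative ρ q) × (∀ q → Negative ρ q → Bead 1 ν q)

  represents-empty : Represents [] (λ q → q)
  represents-empty = tt , (λ { q (d , e) → tail⇒negative q d e }) , negative⇒tail

  represents-ext : ∀ {ν ρ ρ'} → (∀ q → ρ q ≡ ρ' q) → Represents ν ρ → Represents ν ρ'
  represents-ext eq (a , b , c) =
    a , (λ q m → subst (λ x → blk x <ℤ 0ℤ) (eq q) (b q m)) , (λ q l → c q (subst (λ x → blk x <ℤ 0ℤ) (sym (eq q)) l))

  module UpStep (i : F) (u : Word) (up : blk (σ u (lo i)) <ℤ blk (σ u (hi i))) where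
    open AddBoxes k' i

    ρ : Pos → Pos
    ρ = σ u

    Neg : Pos → Set
    Neg = Negative ρ

    blk-ρ-shift : ∀ m p → blk (ρ (shift m p)) ≡ blk (ρ p) +ℤ m
    blk-ρ-shift m p = cong blk (σ-shift u m p)

    -- by periodicity, ρ raises the block across every pair of i
    up-everywhere : ∀ y → res y ≡ prev i → blk (ρ y) <ℤ blk (ρ (sucP y))
    up-everywhere y e =
      subst₂ _<ℤ_ (sym lower) (sym upper) (ℤP.+-monoˡ-< (blk y) up)
      where
      y-shift : y ≡ shift (blk y) (lo i)
      y-shift = lo-shift i y e
      lower : blk (ρ y) ≡ blk (ρ (lo i)) +ℤ blk y
      lower = trans (cong (λ x → blk (ρ x)) y-shift) (blk-ρ-shift (blk y) (lo i))
      upper : blk (ρ (sucP y)) ≡ blk (ρ (hi i)) +ℤ blk y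
      upper = trans (cong (λ x → blk (ρ (sucP x))) y-shift)
                (trans (cong (λ x → blk (ρ x)) (shift-sucP (blk y) (lo i))) (blk-ρ-shift (blk y) (hi i)))

    -- so no bead can be pushed down by s_i
    no-down : ∀ y → res y ≡ prev i → Neg (sucP y) → Neg y
    no-down y e n = ℤP.<-trans (up-everywhere y e) n

    module _ (ν : List ℕ) (rep : Represents ν ρ) where
      bead⇒neg : ∀ q → Bead 1 ν q → Neg q
      bead⇒neg = proj₁ (proj₂ rep)

      neg⇒bead : ∀ q → Neg q → Bead 1 ν q
      neg⇒bead = proj₂ (proj₂ rep)

      -- a movable bead: the block shift of lo i that ρ sends to block -1;
      -- ρ sends the position above it to a block ≥ 0 since ρ is up on i
      depth : ℤ.ℤ
      depth = - (blk (ρ (lo i)) +ℤ 1ℤ)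

      witness : Pos
      witness = shift depth (lo i)

      witness-neg : Neg witness
      witness-neg = subst (_<ℤ 0ℤ) (sym (trans (blk-ρ-shift depth (lo i)) (to-minus-one (blk (ρ (lo i)))))) ℤ.-<+
        where to-minus-one : ∀ a → a +ℤ (- (a +ℤ 1ℤ)) ≡ -1ℤ
              to-minus-one = solve-∀

      above-witness : sucP witness ≡ shift depth (hi i)
      above-witness = shift-sucP depth (lo i)

      above-witness-nonneg : ¬ Neg (sucP witness)
      above-witness-nonneg n = not-below (blk (ρ (lo i))) (blk (ρ (hi i))) up
        (subst (_<ℤ 0ℤ) (trans (cong (λ x → blk (ρ x)) above-witness) (blk-ρ-shift depth (hi i))) n)
        where
        not-below : ∀ a b → a <ℤ b → b +ℤ (- (a +ℤ 1ℤ)) <ℤ 0ℤ → ⊥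
        not-below a b lt h = ℤP.<-irrefl (ℤP.+-comm 1ℤ a) (ℤP.≤-<-trans (ℤP.i<j⇒suc[i]≤j lt) b<a+1)
          where
          cancel : ∀ a b → b +ℤ (- (a +ℤ 1ℤ)) +ℤ (a +ℤ 1ℤ) ≡ b
          cancel = solve-∀
          zero-left : ∀ a → 0ℤ +ℤ (a +ℤ 1ℤ) ≡ a +ℤ 1ℤ
          zero-left = solve-∀
          b<a+1 : b <ℤ a +ℤ 1ℤ
          b<a+1 = subst₂ _<ℤ_ (cancel a b) (zero-left a) (ℤP.+-monoˡ-< (a +ℤ 1ℤ) h)

      witness-movable : Movable 0 nothing ν witness
      witness-movable = trans (cong res above-witness) (res-hi i) , (λ m → above-witness-nonneg (bead⇒neg _ m)) , tt

      module Moved (ν' : List ℕ) (spec : AddAllSpec 0 nothing ν (ν' , true)) where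
        open AddAllSpec spec

        new-sound : ∀ q → Bead 1 ν' q → Neg (act i q)
        new-sound q m with sound q m
        ... | inj₂ (y , my , (ry , _ , _) , refl) = subst Neg (sym (trans (act-hi i (sucP y) ry) (predP-sucP y))) (bead⇒neg y my)
        ... | inj₁ (mq , stuck) = by-cases (res q ≟F prev i) (res q ≟F i)
          where
          by-cases : Dec (res q ≡ prev i) → Dec (res q ≡ i) → Neg (act i q)
          by-cases (yes e) _ = subst Neg (sym (act-lo i q e)) (above-neg (Neg? (sucP q)))
            where
            Neg? : ∀ q → Dec (Neg q)
            Neg? q = blk (ρ q) ℤP.<? 0ℤ
            -- q was not movable, so the position above it is a bead
            above-neg : Dec (Neg (sucP q)) → Neg (sucP q)
            above-neg (yes n) = n
            above-neg (no nn) = ⊥-elim (stuck (trans (res-sucP q) (trans (cong next e) (next-prev i)) , (λ m → nn (bead⇒neg _ m)) , tt))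
          by-cases (no _) (yes e) =
            subst Neg (sym (act-hi i q e))
              (ℤP.<-trans (subst (λ x → blk (ρ (predP q)) <ℤ blk (ρ x)) (sucP-predP q) (up-everywhere (predP q) (trans (res-predP q) (cong prev e))))
                          (bead⇒neg q mq))
          by-cases (no n1) (no n2) = subst Neg (sym (act-oth i q n1 n2)) (bead⇒neg q mq)

        new-complete : ∀ q → Neg (act i q) → Bead 1 ν' q
        new-complete q n = by-cases (res q ≟F prev i) (res q ≟F i)
          where
          by-cases : Dec (res q ≡ prev i) → Dec (res q ≡ i) → Bead 1 ν' q
          by-cases (yes e) _ =
            complete q (inj₁ (neg⇒bead q (no-down q e n-above) , λ { (_ , nm , _) → nm (neg⇒bead _ n-above) }))
            where
            n-above : Neg (sucP q)
            n-above = subst Neg (act-lo i q e) n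
          by-cases (no _) (yes e) with blk (ρ q) ℤP.<? 0ℤ
          ... | yes nq = complete q (inj₁ (neg⇒bead q nq , λ { (r , _ , _) → next≢ i (trans (sym (trans (res-sucP q) (cong next e))) r) }))
          ... | no nnq =
            complete q (inj₂ (predP q , neg⇒bead _ (subst Neg (act-hi i q e) n)
                             , (trans (cong res (sucP-predP q)) e , (λ m → nnq (bead⇒neg q (subst (Bead 1 ν) (sucP-predP q) m))) , tt)
                             , sym (sucP-predP q)))
          by-cases (no n1) (no n2) =
            complete q (inj₁ (neg⇒bead q (subst Neg (act-oth i q n1 n2) n)
                             , λ { (r , _ , _) → n1 (trans (sym (prev-next (res q))) (cong prev (trans (sym (res-sucP q)) r))) }))

        represents-moved : Represents ν' (λ q → ρ (act i q))
        represents-moved = shape , new-sound , new-complete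

      step : ∃ λ ν' → uAct k i ν ≡ just ν' × Represents ν' (λ q → ρ (act i q))
      step with addAll k i 1 nothing ν | addAll-spec 0 nothing ν tt (proj₁ rep)
      ... | (ν' , true) | spec = ν' , refl , Moved.represents-moved ν' spec
      ... | (ν' , false) | spec with AddAllSpec.flag spec witness (neg⇒bead witness witness-neg) witness-movable
      ...   | ()

  -- every letter of w, read from the right, is applied in an up step
  AllUp : Word → Set
  AllUp w = ∀ a b i → w ≡ a ++ i ∷ b → blk (σ (reverse b) (lo i)) <ℤ blk (σ (reverse b) (hi i))

  uWord-represents : ∀ w → AllUp w → ∃ λ ν → uWord k w [] ≡ just ν × Represents ν (σ (reverse w))
  uWord-represents [] g = [] , refl , represents-empty
  uWord-represents (i ∷ w') g with uWord-represents w' (λ a b j e → g (i ∷ a) b j (cong (i ∷_) e))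
  ... | ν , eq , rep with UpStep.step i (reverse w') (g [] w' i refl) ν rep
  ...   | ν' , e2 , rep' = ν' , trans (cong (_>>= uAct k i) eq) e2 , represents-ext ext rep'
    where
    ext : ∀ q → σ (reverse w') (act i q) ≡ σ (reverse (i ∷ w')) q
    ext q = sym (trans (cong (λ x → σ x q) (unfold-reverse i w')) (σ-++ (reverse w') [ i ] q))

  uWord-nonzero : ∀ w → AllUp w → uWord k w [] ≢ nothing
  uWord-nonzero w g e with uWord-represents w g
  ... | ν , e' , _ with trans (sym e) e'
  ...   | ()


module UpSteps (k' : ℕ) where
  -- A letter i with
  -- w = c ++ i ∷ b reduced yields a pair γ₁ < γ₂ (the root b⁻¹α_i) that w
  -- inverts.  For a letter of x, γ₁ and γ₂ cannot lie in one block because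
  -- t_α preserves the order inside blocks (α dominant).  For a letter of y,
  -- the same holds since y is increasing on each block (y ∈ W^0), and then
  -- residues decrease, so the translation by α (dominant) keeps the blocks
  -- strictly ordered.

  open import Data.Nat using (ℕ; suc; _≤_; _<_)
  import Data.Nat.Properties as ℕP
  open import Data.Fin using (Fin; suc; toℕ; inject₁)
  open import Data.Integer as ℤ using (ℤ; -_; 0ℤ) renaming (_+_ to _+ℤ_; _-_ to _-ℤ_; _<_ to _<ℤ_)
  import Data.Integer.Properties as ℤP
  open import Data.Integer.Tactic.RingSolver using (solve-∀)
  open import Relation.Binary.PropositionalEquality hiding ([_])
  open import Relation.Nullary using (yes; no)
  open import Data.Empty using (⊥; ⊥-elim)
  open import Data.Sum using (_⊎_; inj₁; inj₂)
  open import Data.Product using (_,_; ∃; _×_)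
  open import Data.List using ([]; _∷_; _++_; reverse; [_])
  import Data.List.Properties as LP
  open import Data.List.Relation.Unary.All using (_∷_; [])
  open import Defs using (InW0; Reduced; Dominant; IsTranslation)
  open Cyclic
  open Abacus k'
  open Words k'
  open Order k'
  open Positivity k'
  open DiamondAction k'
  open Cores k'

  split++ : ∀ (y x a b : Word) (i : F) → y ++ x ≡ a ++ i ∷ b →
            (∃ λ c → a ≡ y ++ c × x ≡ c ++ i ∷ b) ⊎ (∃ λ d → y ≡ a ++ i ∷ d × b ≡ d ++ x)
  split++ [] x a b i e = inj₁ (a , refl , e)
  split++ (t ∷ y) x [] b i e with LP.∷-injective e
  ... | refl , e2 = inj₂ (y , refl , sym e2)
  split++ (t ∷ y) x (t' ∷ a) b i e with LP.∷-injective e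
  ... | refl , e2 with split++ y x a b i e2
  ...   | inj₁ (c , refl , e3) = inj₁ (c , refl , e3)
  ...   | inj₂ (d , refl , e3) = inj₂ (d , refl , e3)

  -- The letter i of a reduced word w = c ++ i ∷ b: b⁻¹ keeps the pair of i
  -- in order, while w inverts the resulting pair (as c keeps it in order).
  letter-inversion : ∀ c b i → Red (c ++ i ∷ b) →
    σ (reverse b) (lo i) <P σ (reverse b) (hi i) ×
    σ (c ++ i ∷ b) (σ (reverse b) (hi i)) <P σ (c ++ i ∷ b) (σ (reverse b) (lo i))
  letter-inversion c b i red =
    positive-of-reduced (reverse b) i red-right ,
    subst₂ _<P_ (sym (moves (hi i) (lo i) (act-hi-s i))) (sym (moves (lo i) (hi i) (act-lo-s i))) (positive-of-reduced c i red-left)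
    where
    red-left : Red (c ++ [ i ])
    red-left = red-prefix (c ++ [ i ]) b (subst Red (sym (LP.++-assoc c [ i ] b)) red)
    red-right : Red (reverse b ++ [ i ])
    red-right = red-prefix (reverse b ++ [ i ]) (reverse c)
                  (subst Red (trans (LP.reverse-++ c (i ∷ b)) (cong (_++ reverse c) (LP.unfold-reverse i b))) (red-rev _ red))
    moves : ∀ p p' → act i p ≡ p' → σ (c ++ i ∷ b) (σ (reverse b) p) ≡ σ c p'
    moves p p' e = trans (σ-++ c (i ∷ b) _) (trans (cong (λ z → σ c (act i z)) (σ-rev-r b p)) (cong (σ c) e))

  shift-pos : ∀ m p → 0ℤ <ℤ m → p <P shift m p
  shift-pos m ⟨ B , r ⟩ lt = inj₁ (subst (_<ℤ B +ℤ m) (ℤP.+-identityʳ B) (ℤP.+-monoʳ-< B lt))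

  -- an element of W^0 is increasing on each block (the window of y is sorted)
  module Window (y : Word) (inw : InW0 k y) where
    red-y : Red y
    red-y z z≈ = inw [] [] z (≈subst refl (sym (LP.++-identityʳ y)) z≈)

    window-step : ∀ B j → σ y ⟨ B , inject₁ j ⟩ <P σ y ⟨ B , suc j ⟩
    window-step B j =
      subst (λ z → σ y ⟨ B , inject₁ j ⟩ <P σ y z) (sucP-inject₁ B j)
        (pos-at y (suc j) ⟨ B , inject₁ j ⟩ (positive-of-reduced y (suc j) (red-snoc y (suc j) (inw [ suc j ] ((λ ()) ∷ [])))) refl)

    window-increasing : ∀ B (r1 r2 : F) → toℕ r1 < toℕ r2 → σ y ⟨ B , r1 ⟩ <P σ y ⟨ B , r2 ⟩
    window-increasing B = increasing _<P_ <P-trans (λ r → σ y ⟨ B , r ⟩) (window-step B)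

    inverted-pair : ∀ γ₁ γ₂ → γ₁ <P γ₂ → σ y γ₂ <P σ y γ₁ → blk γ₁ <ℤ blk γ₂ × toℕ (res γ₂) ≤ toℕ (res γ₁)
    inverted-pair ⟨ B₁ , r₁ ⟩ ⟨ B₂ , r₂ ⟩ (inj₂ (refl , lt)) inv = ⊥-elim (<P-asym (window-increasing B₁ r₁ r₂ lt) inv)
    inverted-pair ⟨ B₁ , r₁ ⟩ ⟨ B₂ , r₂ ⟩ (inj₁ B₁<B₂) inv = B₁<B₂ , ℕP.≮⇒≥ residues-up
      where
      -- otherwise σ y γ₁ < σ y ⟨ B₁ , r₂ ⟩ < σ y γ₂, the latter a block shift
      residues-up : toℕ r₁ < toℕ r₂ → ⊥
      residues-up lt = <P-asym inv (<P-trans (window-increasing B₁ r₁ r₂ lt) (subst (σ y ⟨ B₁ , r₂ ⟩ <P_) shifted (shift-pos (B₂ -ℤ B₁) _ gap)))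
        where
        gap : 0ℤ <ℤ B₂ -ℤ B₁
        gap = subst₂ _<ℤ_ (ℤP.+-inverseʳ B₁) refl (ℤP.+-monoˡ-< (- B₁) B₁<B₂)
        shifted : shift (B₂ -ℤ B₁) (σ y ⟨ B₁ , r₂ ⟩) ≡ σ y ⟨ B₂ , r₂ ⟩
        shifted = trans (sym (σ-shift y (B₂ -ℤ B₁) ⟨ B₁ , r₂ ⟩)) (cong (λ B → σ y ⟨ B , r₂ ⟩) (telescope B₁ B₂))
          where telescope : ∀ a b → a +ℤ (b -ℤ a) ≡ b
                telescope = solve-∀

  module Main (y : Word) (inw : InW0 k y) (α : Fin (suc k) → ℤ) (dom : Dominant k α)
              (x : Word) (redx : Reduced k x) (tr : IsTranslation k x α) where
    open Trans x α tr
    open Window y inw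

    -- t_α preserves the order inside a block, as α is dominant
    translation-mono : ∀ p q → blk p ≡ blk q → toℕ (res p) < toℕ (res q) → σ x p <P σ x q
    translation-mono ⟨ B , r1 ⟩ ⟨ .B , r2 ⟩ refl lt rewrite σx B r1 | σx B r2 with (- α r1 +ℤ B) ℤ.≟ (- α r2 +ℤ B)
    ... | yes e = inj₂ (e , lt)
    ... | no ne = inj₁ (ℤP.≤∧≢⇒< (ℤP.+-monoˡ-≤ B (ℤP.neg-mono-≤ (dom r1 r2 (ℕP.<⇒≤ lt)))) ne)

    up-in-x : ∀ c b i → x ≡ c ++ i ∷ b → blk (σ (reverse b) (lo i)) <ℤ blk (σ (reverse b) (hi i))
    up-in-x c b i ex with letter-inversion c b i (subst Red ex redx)
    ... | inj₁ l , _ = l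
    ... | inj₂ (eb , lr) , inv =
      ⊥-elim (<P-asym (translation-mono _ _ eb lr) (subst (λ w → σ w _ <P σ w _) (sym ex) inv))

    up-in-y : ∀ a d i → y ≡ a ++ i ∷ d → blk (σ (reverse (d ++ x)) (lo i)) <ℤ blk (σ (reverse (d ++ x)) (hi i))
    up-in-y a d i ey with letter-inversion a d i (subst Red ey red-y)
    ... | pair , inv with inverted-pair γ₁ γ₂ pair (subst (λ w → σ w γ₂ <P σ w γ₁) (sym ey) inv)
      where
      γ₁ γ₂ : Pos
      γ₁ = σ (reverse d) (lo i)
      γ₂ = σ (reverse d) (hi i)
    ... | blocks-up , residues-down =
      subst₂ _<ℤ_ (sym (after-x (lo i))) (sym (after-x (hi i))) (ℤP.+-mono-<-≤ blocks-up (dom _ _ residues-down))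
      where
      after-x : ∀ p → blk (σ (reverse (d ++ x)) p) ≡ blk (σ (reverse d) p) +ℤ α (res (σ (reverse d) p))
      after-x p = cong blk (trans (cong (λ w → σ w p) (LP.reverse-++ d x)) (trans (σ-++ (reverse x) (reverse d) p) (σrx _ _)))

    all-up : AllUp (y ++ x)
    all-up a b i e with split++ y x a b i e
    ... | inj₁ (c , refl , ex) = up-in-x c b i ex
    ... | inj₂ (d , ey , refl) = up-in-y a d i ey


open import Defs using (Word; InW0; RootLattice; Dominant; Reduced; IsTranslation; uWord)
open import Data.Nat using (_≤_)
open import Data.Integer using (ℤ)
open import Data.List using ([]; _++_)
open import Data.Maybe using (nothing)
open import Relation.Binary.PropositionalEquality using (_≢_)

-- u(y) u(x) ∅ = uWord (y ++ x) ∅ is nonzero because every letter of y ++ x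
-- is applied in an up step.  (The root lattice hypothesis is implicit in
-- the existence of the word x for t_α.)
lemma4p7 : (k : ℕ) → 1 ≤ k →
    (y : Word k) → InW0 k y →
    (α : Fin (suc k) → ℤ) → RootLattice k α → Dominant k α →
    (x : Word k) → Reduced k x → IsTranslation k x α →
    uWord k (y ++ x) [] ≢ nothing
lemma4p7 (suc k') _ y inw α _ dom x red tr =
  Cores.uWord-nonzero k' (y ++ x) (UpSteps.Main.all-up k' y inw α dom x red tr)
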